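{- Suppose $\vdash_{\mathit{RS}_{1.1}^- } f:\gamma_1\to\gamma_0$ where $\gamma_1$ is normal. Then $f$ is DP-poly-cost, i.e. there is a polynomial $q$ such that for every type-$\gamma_1$ value $v$, the cost of evaluating $f$ on $v$ under the dynamic-programming semantics is at most $q(\mathrm{size}(v))$.
   Context: $S_1^-$ is a first-order call-by-value typed $\lambda$-calculus with ground types built from $\mathsf{unit}$ and inductive data types $\mu P$ ($P$ a polynomial functor built from $\mathrm{Id}$, constant functors, $+,\times$; $\mu P$ its nonempty least fixed point) using $+,\times$; terms: $\lambda$, application, pairs/projections, injections/case, constructors $\mathsf{c}_{\mu P}:P(\mu P)\to\mu P$, destructors $\mathsf{d}_{\mu P}:\mu P\to P(\mu P)$ and structural recursion $\mathsf{fold}_{\mu P} f\,e$ ($(\mathsf{fold} f)\circ\mathsf{c}=f\circ P(\mathsf{fold} f)$). Values are rooted labelled dags (vertices $\underline{()}$, $\underline\iota_j$, pair, $\underline{\mathsf c}_{\mu P}$) with sharing; bisimilar values unfold to the same tree; $\mathrm{size}(v)$ = number of $\underline{\mathsf c}_{\mu P}$ vertices. The dynamic-programming (DP) semantics is call-by-value evaluation where constructors create a fresh vertex and folds are evaluated bottom-up over the argument dag, memoizing the result at each vertex; the DP-cost of an evaluation is the number of nodes of its derivation tree. $\mathit{RS}^-_1$ ramifies $S_1^-$: each ground type $\gamma$ has a safe version $\mathsf S\gamma$ ($\mathsf S$ distributing over $+,\times$), with safe constructors/destructors; $\mathsf{fold}_\delta(\lambda z.e_0)\,e_1$ requires $e_1:\delta$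 normal and $\lambda z.e_0:P(\mathsf S\gamma)\to\mathsf S\gamma$, of type $\mathsf S\gamma$; case needs normal scrutinee type or safe result type; $\mathsf{toSafe}:\gamma\to\mathsf S\gamma$; $\mathsf{toNorm}:\gamma\to\mathsf N\gamma$ only if all free variables of its argument have normal type. A type is normal if all its base types are non-safe. Semantics: the DP semantics, coercions are identities. $\mathit{RS}_{1.1}^-$ adds, for each data type $\delta$, a primitive $\mathsf{cs}_\delta$ ($e:\delta\vdash\mathsf{cs}_\delta e:\mathsf{nat}$, $\mathsf{nat}=\mu(\mathsf C_{\mathsf{unit}}+\mathrm{Id})$) returning the numeral of $\min\{\mathrm{size}(v')\mid v'\text{ bisimilar to the value of }e\}$. -}

module Defs where

open import Data.Nat using (ℕ; zero; suc; _+_; _*_; _^_; _≤_; _<_; _≡ᵇ_)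
open import Data.Bool using (Bool; true; false; if_then_else_)
open import Data.List using (List; []; _∷_; length; _∷ʳ_)
open import Data.List.Relation.Unary.All using (All; []; _∷_)
open import Data.Maybe using (Maybe; just; nothing)
open import Data.Product using (Σ; ∃; _×_; _,_; proj₁; proj₂)
open import Data.Sum using (_⊎_)
open import Data.Unit using (⊤)
open import Data.Empty using (⊥)
open import Relation.Binary.PropositionalEquality using (_≡_)

mutual
  data Ty : Set where
    unit : Ty
    _⊕_  : Ty → Ty → Ty
    _⊗_  : Ty → Ty → Ty
    μ    : PF → Ty

  data PF : Set where
    Id   : PF
    K    : Ty → PF
    _⊕_  : PF → PF → PF
    _⊗_  : PF → PF → PF

PappTy : PF → Ty → Ty
PappTy Id      t = t
PappTy (K s)   t = s
PappTy (P ⊕ Q) t = PappTy P t ⊕ PappTy Q t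
PappTy (P ⊗ Q) t = PappTy P t ⊗ PappTy Q t

natF : PF
natF = K unit ⊕ Id

-- RS ground types: every base type (unit, μP) comes in a normal and a
-- safe version; S distributes over + and ×.

data Mode : Set where
  nrm sfe : Mode

data GTy : Set where
  unit : Mode → GTy
  μ    : Mode → PF → GTy
  _⊕_  : GTy → GTy → GTy
  _⊗_  : GTy → GTy → GTy

⌈_⌉ : Ty → GTy
⌈ unit ⌉  = unit nrm
⌈ s ⊕ t ⌉ = ⌈ s ⌉ ⊕ ⌈ t ⌉
⌈ s ⊗ t ⌉ = ⌈ s ⌉ ⊗ ⌈ t ⌉
⌈ μ P ⌉   = μ nrm P

Papp : PF → GTy → GTy
Papp Id      g = g
Papp (K s)   g = ⌈ s ⌉
Papp (P ⊕ Q) g = Papp P g ⊕ Papp Q g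
Papp (P ⊗ Q) g = Papp P g ⊗ Papp Q g

setMode : Mode → GTy → GTy
setMode m (unit _) = unit m
setMode m (μ _ P)  = μ m P
setMode m (g ⊕ h)  = setMode m g ⊕ setMode m h
setMode m (g ⊗ h)  = setMode m g ⊗ setMode m h

S N : GTy → GTy
S = setMode sfe
N = setMode nrm

-- forget safety annotations (coercions are identities)
erase : GTy → Ty
erase (unit _) = unit
erase (μ _ P)  = μ P
erase (g ⊕ h)  = erase g ⊕ erase h
erase (g ⊗ h)  = erase g ⊗ erase h

AllMode : Mode → GTy → Set
AllMode nrm (unit nrm) = ⊤
AllMode nrm (unit sfe) = ⊥
AllMode sfe (unit nrm) = ⊥
AllMode sfe (unit sfe) = ⊤
AllMode nrm (μ nrm P)  = ⊤
AllMode nrm (μ sfe P)  = ⊥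
AllMode sfe (μ nrm P)  = ⊥
AllMode sfe (μ sfe P)  = ⊤
AllMode m (g ⊕ h)      = AllMode m g × AllMode m h
AllMode m (g ⊗ h)      = AllMode m g × AllMode m h

data Type : Set where
  gr  : GTy → Type
  _⇒_ : GTy → Type → Type

AllModeT : Mode → Type → Set
AllModeT m (gr g)  = AllMode m g
AllModeT m (g ⇒ t) = AllMode m g × AllModeT m t

NormalG : GTy → Set
NormalG = AllMode nrm

NormalT SafeT : Type → Set
NormalT = AllModeT nrm
SafeT   = AllModeT sfe

Ctx : Set
Ctx = List GTy

data _∋_ : Ctx → GTy → Set where
  here  : ∀ {Γ g} → (g ∷ Γ) ∋ g
  there : ∀ {Γ g h} → Γ ∋ g → (h ∷ Γ) ∋ g

data _⊆_ : Ctx → Ctx → Set where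
  done : [] ⊆ []
  keep : ∀ {Δ Γ g} → Δ ⊆ Γ → (g ∷ Δ) ⊆ (g ∷ Γ)
  drop : ∀ {Δ Γ g} → Δ ⊆ Γ → Δ ⊆ (g ∷ Γ)

data Term (Γ : Ctx) : Type → Set where
  var    : ∀ {g} → Γ ∋ g → Term Γ (gr g)
  unit   : Term Γ (gr (unit nrm))
  lam    : ∀ {g t} → Term (g ∷ Γ) t → Term Γ (g ⇒ t)
  app    : ∀ {g t} → Term Γ (g ⇒ t) → Term Γ (gr g) → Term Γ t
  pair   : ∀ {g h} → Term Γ (gr g) → Term Γ (gr h) → Term Γ (gr (g ⊗ h))
  fst    : ∀ {g h} → Term Γ (gr (g ⊗ h)) → Term Γ (gr g)
  snd    : ∀ {g h} → Term Γ (gr (g ⊗ h)) → Term Γ (gr h)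
  inl    : ∀ {g h} → Term Γ (gr g) → Term Γ (gr (g ⊕ h))
  inr    : ∀ {g h} → Term Γ (gr h) → Term Γ (gr (g ⊕ h))
  case   : ∀ {g h t} → Term Γ (gr (g ⊕ h)) → NormalG (g ⊕ h) ⊎ SafeT t →
           Term (g ∷ Γ) t → Term (h ∷ Γ) t → Term Γ t
  con    : (P : PF) → Term Γ (gr (Papp P (μ nrm P))) → Term Γ (gr (μ nrm P))
  des    : (P : PF) → Term Γ (gr (μ nrm P)) → Term Γ (gr (Papp P (μ nrm P)))
  scon   : (P : PF) → Term Γ (gr (S (Papp P (μ nrm P)))) → Term Γ (gr (μ sfe P))
  sdes   : (P : PF) → Term Γ (gr (μ sfe P)) → Term Γ (gr (S (Papp P (μ nrm P))))
  fold   : (P : PF) (g : GTy) → Term (Papp P (S g) ∷ Γ) (gr (S g)) →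
           Term Γ (gr (μ nrm P)) → Term Γ (gr (S g))
  toSafe : ∀ {g} → Term Γ (gr g) → Term Γ (gr (S g))
  -- toNorm e is allowed only if all free variables of e have normal type:
  -- e lives in a sub-context Δ of Γ consisting of normal types only
  toNorm : ∀ {Δ g} → Δ ⊆ Γ → All NormalG Δ → Term Δ (gr g) → Term Γ (gr (N g))
  cs     : (P : PF) → Term Γ (gr (μ nrm P)) → Term Γ (gr ⌈ μ natF ⌉)

-- Values: rooted labelled dags stored in a heap.  A heap is a list of
-- vertices; the address of a vertex is its position; fresh vertices are
-- appended at the end.

data Side : Set where
  ι₁ ι₂ : Side

data Vertex : Set where
  vunit : Vertex
  vinj  : Side → ℕ → Vertex
  vpair : ℕ → ℕ → Vertex
  vcon  : PF → ℕ → Vertex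

Heap : Set
Heap = List Vertex

_!_ : {A : Set} → List A → ℕ → Maybe A
[] ! _           = nothing
(x ∷ xs) ! zero  = just x
(x ∷ xs) ! suc n = xs ! n

alloc : Heap → Vertex → Heap × ℕ
alloc H v = (H ∷ʳ v , length H)

data ChildOf : Vertex → ℕ → Set where
  cinj  : ∀ {s b} → ChildOf (vinj s b) b
  cpair₁ : ∀ {b c} → ChildOf (vpair b c) b
  cpair₂ : ∀ {b c} → ChildOf (vpair b c) c
  ccon  : ∀ {P b} → ChildOf (vcon P b) b

WF : Heap → Set
WF H = ∀ a v b → H ! a ≡ just v → ChildOf v b → b < a

data Reach (H : Heap) : ℕ → ℕ → Set where
  rrefl : ∀ {a} → Reach H a a
  rstep : ∀ {a v b c} → H ! a ≡ just v → ChildOf v b → Reach H b c → Reach H a c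

record Dag : Set where
  field
    heap   : Heap
    root   : ℕ
    wf     : WF heap
    rootOk : root < length heap
    rooted : ∀ b → b < length heap → Reach heap root b
open Dag public

countCon : Heap → ℕ
countCon []              = 0
countCon (vcon _ _ ∷ H)  = suc (countCon H)
countCon (_ ∷ H)         = countCon H

size : Dag → ℕ
size d = countCon (heap d)

data ValTy (H : Heap) : ℕ → Ty → Set where
  tunit : ∀ {a} → H ! a ≡ just vunit → ValTy H a unit
  tinl  : ∀ {a b s t} → H ! a ≡ just (vinj ι₁ b) → ValTy H b s → ValTy H a (s ⊕ t)
  tinr  : ∀ {a b s t} → H ! a ≡ just (vinj ι₂ b) → ValTy H b t → ValTy H a (s ⊕ t)
  tpair : ∀ {a b c s t} → H ! a ≡ just (vpair b c) → ValTy H b s → ValTy H c t →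
          ValTy H a (s ⊗ t)
  tcon  : ∀ {a b P} → H ! a ≡ just (vcon P b) → ValTy H b (PappTy P (μ P)) →
          ValTy H a (μ P)

-- unfolding of a dag into a tree; bisimilar values unfold to the same tree
data Tree : Set where
  tunit : Tree
  tinj  : Side → Tree → Tree
  tpair : Tree → Tree → Tree
  tcon  : PF → Tree → Tree

data Unfold (H : Heap) : ℕ → Tree → Set where
  uunit : ∀ {a} → H ! a ≡ just vunit → Unfold H a tunit
  uinj  : ∀ {a s b t} → H ! a ≡ just (vinj s b) → Unfold H b t → Unfold H a (tinj s t)
  upair : ∀ {a b c t u} → H ! a ≡ just (vpair b c) → Unfold H b t → Unfold H c u →
          Unfold H a (tpair t u)
  ucon  : ∀ {a P b t} → H ! a ≡ just (vcon P b) → Unfold H b t → Unfold H a (tcon P t)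

Bisim : Heap → ℕ → Heap → ℕ → Set
Bisim H a H' a' = ∃ λ t → Unfold H a t × Unfold H' a' t

MinSize : Heap → ℕ → ℕ → Set
MinSize H a n =
  (Σ Dag λ d → Bisim H a (heap d) (root d) × size d ≡ n) ×
  (∀ (d : Dag) → Bisim H a (heap d) (root d) → n ≤ size d)

numeral : Heap → ℕ → Heap × ℕ
numeral H zero =
  let (H₁ , u) = alloc H vunit
      (H₂ , i) = alloc H₁ (vinj ι₁ u)
  in alloc H₂ (vcon natF i)
numeral H (suc n) =
  let (H₁ , k) = numeral H n
      (H₂ , i) = alloc H₁ (vinj ι₂ k)
  in alloc H₂ (vcon natF i)

-- DP semantics (call-by-value, big step).  The last index of each
-- judgement is the number of nodes of the derivation tree (the DP-cost).

Env : Ctx → Set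
Env Γ = All (λ _ → ℕ) Γ

lookupEnv : ∀ {Γ g} → Env Γ → Γ ∋ g → ℕ
lookupEnv (a ∷ ρ) here      = a
lookupEnv (a ∷ ρ) (there x) = lookupEnv ρ x

restrict : ∀ {Δ Γ} → Δ ⊆ Γ → Env Γ → Env Δ
restrict done     []      = []
restrict (keep s) (a ∷ ρ) = a ∷ restrict s ρ
restrict (drop s) (a ∷ ρ) = restrict s ρ

data Val : Type → Set where
  addr : ∀ {g} → ℕ → Val (gr g)
  clo  : ∀ {Δ g t} → Env Δ → Term (g ∷ Δ) t → Val (g ⇒ t)

-- memo table of a fold evaluation: vertex ↦ result
Memo : Set
Memo = List (ℕ × ℕ)

lookupM : Memo → ℕ → Maybe ℕ
lookupM []             a = nothing
lookupM ((b , r) ∷ M)  a = if a ≡ᵇ b then just r else lookupM M a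

select : Side → PF → PF → PF
select ι₁ P Q = P
select ι₂ P Q = Q

mutual
  data Eval {Γ : Ctx} : ∀ {t} → Heap → Env Γ → Term Γ t → Heap → Val t → ℕ → Set where
    e-var  : ∀ {H ρ g} {x : Γ ∋ g} → Eval H ρ (var x) H (addr (lookupEnv ρ x)) 1
    e-unit : ∀ {H ρ} → Eval H ρ unit (proj₁ (alloc H vunit)) (addr (proj₂ (alloc H vunit))) 1
    e-lam  : ∀ {H ρ g t} {e : Term (g ∷ Γ) t} → Eval H ρ (lam e) H (clo ρ e) 1
    e-app  : ∀ {H H₁ H₂ H₃ ρ g t Δ} {e₁ : Term Γ (g ⇒ t)} {e₂ : Term Γ (gr g)}
               {ρ' : Env Δ} {b : Term (g ∷ Δ) t} {a : ℕ} {r : Val t} {c₁ c₂ c₃} →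
             Eval H ρ e₁ H₁ (clo ρ' b) c₁ → Eval H₁ ρ e₂ H₂ (addr a) c₂ →
             Eval H₂ (a ∷ ρ') b H₃ r c₃ →
             Eval H ρ (app e₁ e₂) H₃ r (suc (c₁ + c₂ + c₃))
    e-pair : ∀ {H H₁ H₂ ρ g h} {e₁ : Term Γ (gr g)} {e₂ : Term Γ (gr h)} {a b c₁ c₂} →
             Eval H ρ e₁ H₁ (addr a) c₁ → Eval H₁ ρ e₂ H₂ (addr b) c₂ →
             Eval H ρ (pair e₁ e₂) (proj₁ (alloc H₂ (vpair a b)))
                  (addr (proj₂ (alloc H₂ (vpair a b)))) (suc (c₁ + c₂))
    e-fst  : ∀ {H H₁ ρ g h} {e : Term Γ (gr (g ⊗ h))} {a b₁ b₂ c} →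
             Eval H ρ e H₁ (addr a) c → H₁ ! a ≡ just (vpair b₁ b₂) →
             Eval H ρ (fst e) H₁ (addr b₁) (suc c)
    e-snd  : ∀ {H H₁ ρ g h} {e : Term Γ (gr (g ⊗ h))} {a b₁ b₂ c} →
             Eval H ρ e H₁ (addr a) c → H₁ ! a ≡ just (vpair b₁ b₂) →
             Eval H ρ (snd e) H₁ (addr b₂) (suc c)
    e-inl  : ∀ {H H₁ ρ g h} {e : Term Γ (gr g)} {a c} →
             Eval H ρ e H₁ (addr a) c →
             Eval H ρ (inl {h = h} e) (proj₁ (alloc H₁ (vinj ι₁ a)))
                  (addr (proj₂ (alloc H₁ (vinj ι₁ a)))) (suc c)
    e-inr  : ∀ {H H₁ ρ g h} {e : Term Γ (gr h)} {a c} →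
             Eval H ρ e H₁ (addr a) c →
             Eval H ρ (inr {g = g} e) (proj₁ (alloc H₁ (vinj ι₂ a)))
                  (addr (proj₂ (alloc H₁ (vinj ι₂ a)))) (suc c)
    e-case₁ : ∀ {H H₁ H₂ ρ g h t} {e : Term Γ (gr (g ⊕ h))} {ok}
                {e₁ : Term (g ∷ Γ) t} {e₂ : Term (h ∷ Γ) t} {a b r c c₁} →
              Eval H ρ e H₁ (addr a) c → H₁ ! a ≡ just (vinj ι₁ b) →
              Eval H₁ (b ∷ ρ) e₁ H₂ r c₁ →
              Eval H ρ (case e ok e₁ e₂) H₂ r (suc (c + c₁))
    e-case₂ : ∀ {H H₁ H₂ ρ g h t} {e : Term Γ (gr (g ⊕ h))} {ok}
                {e₁ : Term (g ∷ Γ) t} {e₂ : Term (h ∷ Γ) t} {a b r c c₂} →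
              Eval H ρ e H₁ (addr a) c → H₁ ! a ≡ just (vinj ι₂ b) →
              Eval H₁ (b ∷ ρ) e₂ H₂ r c₂ →
              Eval H ρ (case e ok e₁ e₂) H₂ r (suc (c + c₂))
    e-con  : ∀ {H H₁ ρ P} {e : Term Γ (gr (Papp P (μ nrm P)))} {a c} →
             Eval H ρ e H₁ (addr a) c →
             Eval H ρ (con P e) (proj₁ (alloc H₁ (vcon P a)))
                  (addr (proj₂ (alloc H₁ (vcon P a)))) (suc c)
    e-scon : ∀ {H H₁ ρ P} {e : Term Γ (gr (S (Papp P (μ nrm P))))} {a c} →
             Eval H ρ e H₁ (addr a) c →
             Eval H ρ (scon P e) (proj₁ (alloc H₁ (vcon P a)))
                  (addr (proj₂ (alloc H₁ (vcon P a)))) (suc c)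
    e-des  : ∀ {H H₁ ρ P P'} {e : Term Γ (gr (μ nrm P))} {a b c} →
             Eval H ρ e H₁ (addr a) c → H₁ ! a ≡ just (vcon P' b) →
             Eval H ρ (des P e) H₁ (addr b) (suc c)
    e-sdes : ∀ {H H₁ ρ P P'} {e : Term Γ (gr (μ sfe P))} {a b c} →
             Eval H ρ e H₁ (addr a) c → H₁ ! a ≡ just (vcon P' b) →
             Eval H ρ (sdes P e) H₁ (addr b) (suc c)
    e-fold : ∀ {H H₁ H₂ ρ P g} {e₀ : Term (Papp P (S g) ∷ Γ) (gr (S g))}
               {e₁ : Term Γ (gr (μ nrm P))} {a r M c₁ c₂} →
             Eval H ρ e₁ H₁ (addr a) c₁ →
             FoldAt ρ P g e₀ H₁ [] a H₂ M r c₂ →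
             Eval H ρ (fold P g e₀ e₁) H₂ (addr r) (suc (c₁ + c₂))
    e-toSafe : ∀ {H H₁ ρ g} {e : Term Γ (gr g)} {a c} →
               Eval H ρ e H₁ (addr a) c → Eval H ρ (toSafe e) H₁ (addr a) (suc c)
    e-toNorm : ∀ {H H₁ ρ Δ g} {s : Δ ⊆ Γ} {nΔ : All NormalG Δ} {e : Term Δ (gr g)} {a c} →
               Eval H (restrict s ρ) e H₁ (addr a) c →
               Eval H ρ (toNorm s nΔ e) H₁ (addr a) (suc c)
    e-cs   : ∀ {H H₁ ρ P} {e : Term Γ (gr (μ nrm P))} {a n c} →
             Eval H ρ e H₁ (addr a) c → MinSize H₁ a n →
             Eval H ρ (cs P e) (proj₁ (numeral H₁ n)) (addr (proj₂ (numeral H₁ n))) (suc c)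

  -- value of (fold λz.e₀) at vertex a, with memo table
  data FoldAt {Γ : Ctx} (ρ : Env Γ) (P : PF) (g : GTy)
              (e₀ : Term (Papp P (S g) ∷ Γ) (gr (S g))) :
              Heap → Memo → ℕ → Heap → Memo → ℕ → ℕ → Set where
    f-hit  : ∀ {H M a r} → lookupM M a ≡ just r → FoldAt ρ P g e₀ H M a H M r 1
    f-miss : ∀ {H H₁ H₂ M M₁ a P' b b' r c₁ c₂} →
             lookupM M a ≡ nothing → H ! a ≡ just (vcon P' b) →
             PMap ρ P g e₀ P H M b H₁ M₁ b' c₁ →
             Eval H₁ (b' ∷ ρ) e₀ H₂ (addr r) c₂ →
             FoldAt ρ P g e₀ H M a H₂ ((a , r) ∷ M₁) r (suc (c₁ + c₂))

  -- the action of Q(fold λz.e₀) on the value at b (Q a sub-functor of P)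
  data PMap {Γ : Ctx} (ρ : Env Γ) (P : PF) (g : GTy)
            (e₀ : Term (Papp P (S g) ∷ Γ) (gr (S g))) :
            PF → Heap → Memo → ℕ → Heap → Memo → ℕ → ℕ → Set where
    p-id   : ∀ {H H₁ M M₁ b r c} → FoldAt ρ P g e₀ H M b H₁ M₁ r c →
             PMap ρ P g e₀ Id H M b H₁ M₁ r (suc c)
    p-K    : ∀ {H M b t} → PMap ρ P g e₀ (K t) H M b H M b 1
    p-sum  : ∀ {Q₁ Q₂ H H₁ M M₁ b s d d' c} → H ! b ≡ just (vinj s d) →
             PMap ρ P g e₀ (select s Q₁ Q₂) H M d H₁ M₁ d' c →
             PMap ρ P g e₀ (Q₁ ⊕ Q₂) H M b (proj₁ (alloc H₁ (vinj s d')))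
                  M₁ (proj₂ (alloc H₁ (vinj s d'))) (suc c)
    p-prod : ∀ {Q₁ Q₂ H H₁ H₂ M M₁ M₂ b d₁ d₂ d₁' d₂' c₁ c₂} →
             H ! b ≡ just (vpair d₁ d₂) →
             PMap ρ P g e₀ Q₁ H M d₁ H₁ M₁ d₁' c₁ →
             PMap ρ P g e₀ Q₂ H₁ M₁ d₂ H₂ M₂ d₂' c₂ →
             PMap ρ P g e₀ (Q₁ ⊗ Q₂) H M b (proj₁ (alloc H₂ (vpair d₁' d₂')))
                  M₂ (proj₂ (alloc H₂ (vpair d₁' d₂'))) (suc (c₁ + c₂))

data Run {g₁ : GTy} {t : Type} (f : Term [] (g₁ ⇒ t)) (v : Dag) : Heap → Val t → ℕ → Set where
  run : ∀ {Δ H₁ H₂ r c₁ c₂} {ρ' : Env Δ} {b : Term (g₁ ∷ Δ) t} →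
        Eval (heap v) [] f H₁ (clo ρ' b) c₁ →
        Eval H₁ (root v ∷ ρ') b H₂ r c₂ →
        Run f v H₂ r (suc (c₁ + c₂))

-- polynomials with natural coefficients (coefficient list, lowest first)

Polynomial : Set
Polynomial = List ℕ

evalPoly : Polynomial → ℕ → ℕ
evalPoly []       x = 0
evalPoly (a ∷ as) x = a + x * evalPoly as x

DPPolyCost : ∀ {g₁ g₀} → Term [] (g₁ ⇒ gr g₀) → Set
DPPolyCost {g₁} {g₀} f =
  ∃ λ (q : Polynomial) → ∀ (v : Dag) → ValTy (heap v) (root v) (erase g₁) →
    (∃ λ H' → ∃ λ r → ∃ λ c → Run f v H' r c) ×
    (∀ H' r c → Run f v H' r c → c ≤ evalPoly q (size v))

-- A logical relation assigns to every term polynomial bounds on its DP-cost and on the number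
-- of vertices it allocates, as functions of the size of a budget: a list of addresses containing
-- every constructor vertex of the normal data in scope.  Normal data grow only by fresh
-- constructor vertices, which join the budget, and toNorm only sees normal variables, so the
-- budget grows by at most the allocation, itself polynomially bounded.  A fold over a normal
-- argument misses its memo table at most once per constructor vertex of the argument, all of
-- which lie in the budget, and cs returns a numeral no larger than the budget, since the
-- hash-consed dag of a value has no more constructor vertices than the value itself.  For the
-- input v the budget is the set of its constructor vertices, of size size(v).

module Submission where

open import Data.Bool using (true; false; T)
open import Data.Empty using (⊥-elim)
open import Data.List using (List; []; _∷_; [_]; _++_; _∷ʳ_; length; map)
open import Data.List.Properties using (length-++; ++-assoc; ++-identityʳ; length-map; map-++; ++-cancelˡ)
open import Data.List.Membership.Propositional using (_∈_; _∉_)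
open import Data.List.Membership.Propositional.Properties using (∈-++⁺ˡ; ∈-++⁺ʳ; ∈-++⁻; ∈-map⁺; ∈-map⁻)
open import Data.List.Relation.Binary.Subset.Propositional using () renaming (_⊆_ to _⊆ᴸ_)
open import Data.List.Relation.Binary.Subset.Propositional.Properties using (xs⊆xs++ys; ⊆-reflexive; ⊆-trans; ⊆-refl)
open import Data.List.Relation.Unary.All using (All; []; _∷_)
import Data.List.Relation.Unary.All as All
open import Data.List.Relation.Unary.Any using (here; there)
open import Data.List.Relation.Unary.Unique.Propositional using (Unique; []; _∷_)
import Data.List.Relation.Unary.Unique.Propositional.Properties as Unique
open import Data.Maybe using (just; nothing)
open import Data.Maybe.Properties using (just-injective)
open import Data.Nat
open import Data.Nat.Induction using (<-wellFounded)
open import Data.Nat.Properties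
open import Data.Nat.Tactic.RingSolver using (solve-∀)
open import Data.Product using (∃; _×_; _,_; proj₁; proj₂)
open import Data.Sum using (_⊎_; inj₁; inj₂; [_,_]′)
open import Data.Unit using (⊤; tt)
open import Induction.WellFounded using (Acc; acc)
open import Relation.Binary.Definitions using (DecidableEquality)
open import Relation.Binary.PropositionalEquality
  using (_≡_; _≢_; refl; sym; trans; cong; cong₂; subst; module ≡-Reasoning)
open import Relation.Nullary using (yes; no)
open import Relation.Nullary.Decidable using (map′; _×-dec_)

open import Defs

infixl 6 _⊞_
infixl 7 _⊠_

data PolyExpr : Set where
  𝕏       : PolyExpr
  ⌜_⌝     : ℕ → PolyExpr
  _⊞_ _⊠_ : PolyExpr → PolyExpr → PolyExpr

⟦_⟧ : PolyExpr → ℕ → ℕ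
⟦ 𝕏 ⟧     n = n
⟦ ⌜ k ⌝ ⟧ n = k
⟦ p ⊞ q ⟧ n = ⟦ p ⟧ n + ⟦ q ⟧ n
⟦ p ⊠ q ⟧ n = ⟦ p ⟧ n * ⟦ q ⟧ n

_∘ₚ_ : PolyExpr → PolyExpr → PolyExpr
𝕏       ∘ₚ q = q
⌜ k ⌝   ∘ₚ q = ⌜ k ⌝
(p ⊞ p′) ∘ₚ q = (p ∘ₚ q) ⊞ (p′ ∘ₚ q)
(p ⊠ p′) ∘ₚ q = (p ∘ₚ q) ⊠ (p′ ∘ₚ q)

⟦∘ₚ⟧ : ∀ p q n → ⟦ p ∘ₚ q ⟧ n ≡ ⟦ p ⟧ (⟦ q ⟧ n)
⟦∘ₚ⟧ 𝕏        q n = refl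
⟦∘ₚ⟧ ⌜ k ⌝    q n = refl
⟦∘ₚ⟧ (p ⊞ p′) q n = cong₂ _+_ (⟦∘ₚ⟧ p q n) (⟦∘ₚ⟧ p′ q n)
⟦∘ₚ⟧ (p ⊠ p′) q n = cong₂ _*_ (⟦∘ₚ⟧ p q n) (⟦∘ₚ⟧ p′ q n)

⟦⟧-mono : ∀ p {m n} → m ≤ n → ⟦ p ⟧ m ≤ ⟦ p ⟧ n
⟦⟧-mono 𝕏        m≤n = m≤n
⟦⟧-mono ⌜ k ⌝    m≤n = ≤-refl
⟦⟧-mono (p ⊞ q) m≤n = +-mono-≤ (⟦⟧-mono p m≤n) (⟦⟧-mono q m≤n)
⟦⟧-mono (p ⊠ q) m≤n = *-mono-≤ (⟦⟧-mono p m≤n) (⟦⟧-mono q m≤n)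

⟦⟧-mono-∘ₚ : ∀ p q n {m} → m ≤ ⟦ q ⟧ n → ⟦ p ⟧ m ≤ ⟦ p ∘ₚ q ⟧ n
⟦⟧-mono-∘ₚ p q n m≤ = ≤-trans (⟦⟧-mono p m≤) (≤-reflexive (sym (⟦∘ₚ⟧ p q n)))

_+ᴾ_ : Polynomial → Polynomial → Polynomial
[]      +ᴾ q       = q
(a ∷ p) +ᴾ []      = a ∷ p
(a ∷ p) +ᴾ (b ∷ q) = a + b ∷ p +ᴾ q

_·ᴾ_ : ℕ → Polynomial → Polynomial
a ·ᴾ p = map (a *_) p

_*ᴾ_ : Polynomial → Polynomial → Polynomial
[]      *ᴾ q = []
(a ∷ p) *ᴾ q = (a ·ᴾ q) +ᴾ (0 ∷ p *ᴾ q)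

evalPoly-+ᴾ : ∀ p q n → evalPoly (p +ᴾ q) n ≡ evalPoly p n + evalPoly q n
evalPoly-+ᴾ []      q       n = refl
evalPoly-+ᴾ (a ∷ p) []      n = sym (+-identityʳ _)
evalPoly-+ᴾ (a ∷ p) (b ∷ q) n = begin
  a + b + n * evalPoly (p +ᴾ q) n                ≡⟨ cong (λ e → a + b + n * e) (evalPoly-+ᴾ p q n) ⟩
  a + b + n * (evalPoly p n + evalPoly q n)      ≡⟨ shuffle a b n (evalPoly p n) (evalPoly q n) ⟩
  a + n * evalPoly p n + (b + n * evalPoly q n)  ∎
  where
  open ≡-Reasoning
  shuffle : ∀ a b n x y → a + b + n * (x + y) ≡ a + n * x + (b + n * y)
  shuffle = solve-∀

evalPoly-·ᴾ : ∀ a p n → evalPoly (a ·ᴾ p) n ≡ a * evalPoly p n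
evalPoly-·ᴾ a []      n = sym (*-zeroʳ a)
evalPoly-·ᴾ a (b ∷ p) n = begin
  a * b + n * evalPoly (a ·ᴾ p) n  ≡⟨ cong (λ e → a * b + n * e) (evalPoly-·ᴾ a p n) ⟩
  a * b + n * (a * evalPoly p n)   ≡⟨ shuffle a b n (evalPoly p n) ⟩
  a * (b + n * evalPoly p n)       ∎
  where
  open ≡-Reasoning
  shuffle : ∀ a b n x → a * b + n * (a * x) ≡ a * (b + n * x)
  shuffle = solve-∀

evalPoly-*ᴾ : ∀ p q n → evalPoly (p *ᴾ q) n ≡ evalPoly p n * evalPoly q n
evalPoly-*ᴾ []      q n = refl
evalPoly-*ᴾ (a ∷ p) q n = begin
  evalPoly ((a ·ᴾ q) +ᴾ (0 ∷ p *ᴾ q)) n        ≡⟨ evalPoly-+ᴾ (a ·ᴾ q) (0 ∷ p *ᴾ q) n ⟩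
  evalPoly (a ·ᴾ q) n + n * evalPoly (p *ᴾ q) n ≡⟨ cong₂ (λ u v → u + n * v) (evalPoly-·ᴾ a q n) (evalPoly-*ᴾ p q n) ⟩
  a * evalPoly q n + n * (evalPoly p n * evalPoly q n) ≡⟨ shuffle a n (evalPoly p n) (evalPoly q n) ⟩
  (a + n * evalPoly p n) * evalPoly q n         ∎
  where
  open ≡-Reasoning
  shuffle : ∀ a n x y → a * y + n * (x * y) ≡ (a + n * x) * y
  shuffle = solve-∀

toPolynomial : PolyExpr → Polynomial
toPolynomial 𝕏       = 0 ∷ 1 ∷ []
toPolynomial ⌜ k ⌝   = k ∷ []
toPolynomial (p ⊞ q) = toPolynomial p +ᴾ toPolynomial q
toPolynomial (p ⊠ q) = toPolynomial p *ᴾ toPolynomial q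

evalPoly-toPolynomial : ∀ p n → evalPoly (toPolynomial p) n ≡ ⟦ p ⟧ n
evalPoly-toPolynomial 𝕏       n = trans (cong (λ e → n * suc e) (*-zeroʳ n)) (*-identityʳ n)
evalPoly-toPolynomial ⌜ k ⌝   n = trans (cong (k +_) (*-zeroʳ n)) (+-identityʳ k)
evalPoly-toPolynomial (p ⊞ q) n = trans (evalPoly-+ᴾ (toPolynomial p) (toPolynomial q) n)
  (cong₂ _+_ (evalPoly-toPolynomial p n) (evalPoly-toPolynomial q n))
evalPoly-toPolynomial (p ⊠ q) n = trans (evalPoly-*ᴾ (toPolynomial p) (toPolynomial q) n)
  (cong₂ _*_ (evalPoly-toPolynomial p n) (evalPoly-toPolynomial q n))

module _ {A : Set} where

  !-++⁺ : ∀ (xs ys : List A) i {v} → xs ! i ≡ just v → (xs ++ ys) ! i ≡ just v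
  !-++⁺ (x ∷ xs) ys zero    eq = eq
  !-++⁺ (x ∷ xs) ys (suc i) eq = !-++⁺ xs ys i eq

  !-++⁻ : ∀ (xs ys : List A) i {v} → i < length xs → (xs ++ ys) ! i ≡ just v → xs ! i ≡ just v
  !-++⁻ (x ∷ xs) ys zero    _         eq = eq
  !-++⁻ (x ∷ xs) ys (suc i) (s≤s i<) eq = !-++⁻ xs ys i i< eq

  !-just⇒< : ∀ (xs : List A) i {v} → xs ! i ≡ just v → i < length xs
  !-just⇒< (x ∷ xs) zero    eq = s≤s z≤n
  !-just⇒< (x ∷ xs) (suc i) eq = s≤s (!-just⇒< xs i eq)

  <⇒!-just : ∀ (xs : List A) i → i < length xs → ∃ λ v → xs ! i ≡ just v
  <⇒!-just (x ∷ xs) zero    _        = x , refl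
  <⇒!-just (x ∷ xs) (suc i) (s≤s i<) = <⇒!-just xs i i<

  !-functional : ∀ (xs : List A) i {v w} → xs ! i ≡ just v → xs ! i ≡ just w → v ≡ w
  !-functional xs i p q with trans (sym p) q
  ... | refl = refl

  !-∷ʳ-length : ∀ (xs : List A) v → (xs ∷ʳ v) ! length xs ≡ just v
  !-∷ʳ-length []       v = refl
  !-∷ʳ-length (x ∷ xs) v = !-∷ʳ-length xs v

  !-∷ʳ⁻ : ∀ (xs : List A) v i {w} → (xs ∷ʳ v) ! i ≡ just w → xs ! i ≡ just w ⊎ (i ≡ length xs × w ≡ v)
  !-∷ʳ⁻ []       v zero    refl = inj₂ (refl , refl)
  !-∷ʳ⁻ (x ∷ xs) v zero    eq   = inj₁ eq
  !-∷ʳ⁻ (x ∷ xs) v (suc i) eq with !-∷ʳ⁻ xs v i eq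
  ... | inj₁ p          = inj₁ p
  ... | inj₂ (refl , q) = inj₂ (refl , q)

  length-∷ʳ : ∀ (xs : List A) v → length (xs ∷ʳ v) ≡ suc (length xs)
  length-∷ʳ xs v = trans (length-++ xs) (+-comm (length xs) 1)

  length-∷ʳ≥ : ∀ (xs : List A) {v} → length xs < length (xs ∷ʳ v)
  length-∷ʳ≥ xs = ≤-reflexive (sym (length-∷ʳ xs _))

  _⊑_ : List A → List A → Set
  xs ⊑ ys = ∃ λ zs → ys ≡ xs ++ zs

  ⊑-refl : ∀ {xs} → xs ⊑ xs
  ⊑-refl {xs} = [] , sym (++-identityʳ xs)

  ⊑-trans : ∀ {xs ys zs} → xs ⊑ ys → ys ⊑ zs → xs ⊑ zs
  ⊑-trans {xs} (us , refl) (vs , refl) = us ++ vs , ++-assoc xs us vs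

  ⊑-∷ʳ : ∀ {xs} v → xs ⊑ (xs ∷ʳ v)
  ⊑-∷ʳ v = [ v ] , refl

  ⊑-lookup : ∀ {xs ys} → xs ⊑ ys → ∀ {i v} → xs ! i ≡ just v → ys ! i ≡ just v
  ⊑-lookup {xs} (zs , refl) {i} = !-++⁺ xs zs i

  ⊑-length : ∀ {xs ys} → xs ⊑ ys → length xs ≤ length ys
  ⊑-length {xs} (zs , refl) = ≤-trans (m≤m+n _ _) (≤-reflexive (sym (length-++ xs)))

  ∈⇒! : ∀ {x : A} {xs} → x ∈ xs → ∃ λ i → xs ! i ≡ just x
  ∈⇒! (here refl) = zero , refl
  ∈⇒! (there x∈)  = let (i , eq) = ∈⇒! x∈ in suc i , eq

  !⇒∈ : ∀ (xs : List A) i {x} → xs ! i ≡ just x → x ∈ xs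
  !⇒∈ (y ∷ xs) zero    refl = here refl
  !⇒∈ (y ∷ xs) (suc i) eq   = there (!⇒∈ xs i eq)


WF-∷ʳ : ∀ {H} v → WF H → (∀ b → ChildOf v b → b < length H) → WF (H ∷ʳ v)
WF-∷ʳ {H} v wf children< a w b eq child with !-∷ʳ⁻ H v a eq
... | inj₁ old = wf a w b old child
... | inj₂ (refl , refl) = children< b child

reach-trans : ∀ {H a b c} → Reach H a b → Reach H b c → Reach H a c
reach-trans rrefl              r′ = r′
reach-trans (rstep eq child r) r′ = rstep eq child (reach-trans r r′)

reach-≤ : ∀ {H} → WF H → ∀ {a b} → Reach H a b → b ≤ a
reach-≤ wf rrefl = ≤-refl
reach-≤ wf (rstep {a} {v} {b} eq child r) = ≤-trans (reach-≤ wf r) (<⇒≤ (wf a v b eq child))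

-- Old vertices point only to old vertices, so reachability from them is unaffected by growth.
reach-⊑⁻ : ∀ {H H′} → WF H → H ⊑ H′ → ∀ {a b} → a < length H → Reach H′ a b → Reach H a b
reach-⊑⁻ wf ext a< rrefl = rrefl
reach-⊑⁻ {H} wf (X , refl) {a} a< (rstep {v = v} {b = b} eq child r) =
  rstep old child (reach-⊑⁻ wf (X , refl) (<-trans (wf a v b old child) a<) r)
  where old = !-++⁻ H X a a< eq

IsCon : Heap → ℕ → Set
IsCon H b = ∃ λ P → ∃ λ c → H ! b ≡ just (vcon P c)

IsCon⇒< : ∀ H {b} → IsCon H b → b < length H
IsCon⇒< H {b} (_ , _ , eq) = !-just⇒< H b eq

AllCons : Heap → ℕ → (ℕ → Set) → Set
AllCons H a S = ∀ b → Reach H a b → IsCon H b → S b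

AllCons-mono : ∀ {H a} {S S′ : ℕ → Set} → (∀ x → S x → S′ x) → AllCons H a S → AllCons H a S′
AllCons-mono S⊆S′ all b r c = S⊆S′ b (all b r c)

AllCons-reach : ∀ {H a b S} → AllCons H a S → Reach H a b → AllCons H b S
AllCons-reach all r b r′ c = all b (reach-trans r r′) c

AllCons-child : ∀ {H a v b S} → H ! a ≡ just v → ChildOf v b → AllCons H a S → AllCons H b S
AllCons-child eq child all = AllCons-reach all (rstep eq child rrefl)

AllCons-⊑ : ∀ {H H′} → WF H → H ⊑ H′ → ∀ {a S} → a < length H → AllCons H a S → AllCons H′ a S
AllCons-⊑ {H} wf (X , refl) {a} a< all b r (P , c , eq) =
  all b r′ (P , c , !-++⁻ H X b (≤-<-trans (reach-≤ wf r′) a<) eq)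
  where r′ = reach-⊑⁻ wf (X , refl) a< r

AllCons-node : ∀ {H a v S} → H ! a ≡ just v → (∀ P c → v ≡ vcon P c → S a) →
               (∀ b → ChildOf v b → AllCons H b S) → AllCons H a S
AllCons-node {H} {a} eq here-ok _ b rrefl (P , c , eq′) = here-ok P c (!-functional H a eq eq′)
AllCons-node {H} {a} eq _ children-ok b (rstep {b = d} eq′ child r) c
  rewrite !-functional H a eq eq′ = children-ok d child b r c

AllCons-nonCon : ∀ {H a v S} → H ! a ≡ just v → (∀ P c → v ≢ vcon P c) →
                 (∀ b → ChildOf v b → AllCons H b S) → AllCons H a S
AllCons-nonCon eq notCon = AllCons-node eq (λ P c eq′ → ⊥-elim (notCon P c eq′))

ValTy-⊑ : ∀ {H H′} → H ⊑ H′ → ∀ {a t} → ValTy H a t → ValTy H′ a t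
ValTy-⊑ ext (tunit p)     = tunit (⊑-lookup ext p)
ValTy-⊑ ext (tinl p v)    = tinl (⊑-lookup ext p) (ValTy-⊑ ext v)
ValTy-⊑ ext (tinr p v)    = tinr (⊑-lookup ext p) (ValTy-⊑ ext v)
ValTy-⊑ ext (tpair p v w) = tpair (⊑-lookup ext p) (ValTy-⊑ ext v) (ValTy-⊑ ext w)
ValTy-⊑ ext (tcon p v)    = tcon (⊑-lookup ext p) (ValTy-⊑ ext v)

ValTy⇒< : ∀ {H a t} → ValTy H a t → a < length H
ValTy⇒< {H} {a} (tunit p)     = !-just⇒< H a p
ValTy⇒< {H} {a} (tinl p _)    = !-just⇒< H a p
ValTy⇒< {H} {a} (tinr p _)    = !-just⇒< H a p
ValTy⇒< {H} {a} (tpair p _ _) = !-just⇒< H a p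
ValTy⇒< {H} {a} (tcon p _)    = !-just⇒< H a p

module _ {A : Set} where

  ∈-remove : ∀ {x : A} {ys} → x ∈ ys →
             ∃ λ ys′ → length ys ≡ suc (length ys′) × (∀ {z} → z ∈ ys → z ≢ x → z ∈ ys′)
  ∈-remove {ys = y ∷ ys} (here refl) = ys , refl , λ where
    (here refl) z≢x → ⊥-elim (z≢x refl)
    (there z∈)  _   → z∈
  ∈-remove {ys = y ∷ ys} (there x∈) with ∈-remove x∈
  ... | ys′ , eq , retain = y ∷ ys′ , cong suc eq , λ where
    (here refl) _   → here refl
    (there z∈)  z≢x → there (retain z∈ z≢x)

module _ {A B : Set} where

  length-≤-injection : ∀ {L : List A} {M : List B} (R : A → B → Set) → Unique L →
                       (∀ {i} → i ∈ L → ∃ λ y → R i y × y ∈ M) →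
                       (∀ {i j y} → R i y → R j y → i ≡ j) → length L ≤ length M
  length-≤-injection R []         image inj = z≤n
  length-≤-injection R (i∉ ∷ uniq) image inj with image (here refl)
  ... | y , Riy , y∈M with ∈-remove y∈M
  ... | M′ , eq , retain rewrite eq = s≤s (length-≤-injection R uniq image′ inj)
    where
    image′ : ∀ {j} → j ∈ _ → ∃ λ y′ → R j y′ × y′ ∈ M′
    image′ j∈ with image (there j∈)
    ... | y′ , Rjy′ , y′∈M = y′ , Rjy′ , retain y′∈M λ { refl → All.lookup i∉ j∈ (inj Riy Rjy′) }

module _ {A : Set} where

  Unique-⊆⇒length-≤ : ∀ {xs ys : List A} → Unique xs → xs ⊆ᴸ ys → length xs ≤ length ys
  Unique-⊆⇒length-≤ uniq xs⊆ys = length-≤-injection _≡_ uniq (λ x∈ → _ , refl , xs⊆ys x∈) λ { refl refl → refl }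

conAddrs : Heap → List ℕ
conAddrs []               = []
conAddrs (vcon _ _ ∷ H)   = 0 ∷ map suc (conAddrs H)
conAddrs (vunit ∷ H)      = map suc (conAddrs H)
conAddrs (vinj _ _ ∷ H)   = map suc (conAddrs H)
conAddrs (vpair _ _ ∷ H)  = map suc (conAddrs H)

length-conAddrs : ∀ H → length (conAddrs H) ≡ countCon H
length-conAddrs []              = refl
length-conAddrs (vcon _ _ ∷ H)  = cong suc (trans (length-map suc (conAddrs H)) (length-conAddrs H))
length-conAddrs (vunit ∷ H)     = trans (length-map suc (conAddrs H)) (length-conAddrs H)
length-conAddrs (vinj _ _ ∷ H)  = trans (length-map suc (conAddrs H)) (length-conAddrs H)
length-conAddrs (vpair _ _ ∷ H) = trans (length-map suc (conAddrs H)) (length-conAddrs H)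

Unique-conAddrs : ∀ H → Unique (conAddrs H)
Unique-conAddrs []              = []
Unique-conAddrs (vcon _ _ ∷ H)  = All.tabulate (λ x∈ → 0≢suc x∈) ∷ Unique.map⁺ suc-injective (Unique-conAddrs H)
  where
  0≢suc : ∀ {x} → x ∈ map suc (conAddrs H) → 0 ≢ x
  0≢suc x∈ refl with ∈-map⁻ suc x∈
  ... | _ , _ , ()
Unique-conAddrs (vunit ∷ H)     = Unique.map⁺ suc-injective (Unique-conAddrs H)
Unique-conAddrs (vinj _ _ ∷ H)  = Unique.map⁺ suc-injective (Unique-conAddrs H)
Unique-conAddrs (vpair _ _ ∷ H) = Unique.map⁺ suc-injective (Unique-conAddrs H)

IsCon⇒∈conAddrs : ∀ H b → IsCon H b → b ∈ conAddrs H
IsCon⇒∈conAddrs (vcon _ _ ∷ H)  zero    _ = here refl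
IsCon⇒∈conAddrs (vcon _ _ ∷ H)  (suc b) c = there (∈-map⁺ suc (IsCon⇒∈conAddrs H b c))
IsCon⇒∈conAddrs (vunit ∷ H)     (suc b) c = ∈-map⁺ suc (IsCon⇒∈conAddrs H b c)
IsCon⇒∈conAddrs (vinj _ _ ∷ H)  (suc b) c = ∈-map⁺ suc (IsCon⇒∈conAddrs H b c)
IsCon⇒∈conAddrs (vpair _ _ ∷ H) (suc b) c = ∈-map⁺ suc (IsCon⇒∈conAddrs H b c)
IsCon⇒∈conAddrs (vunit ∷ H)     zero    (_ , _ , ())
IsCon⇒∈conAddrs (vinj _ _ ∷ H)  zero    (_ , _ , ())
IsCon⇒∈conAddrs (vpair _ _ ∷ H) zero    (_ , _ , ())

∈conAddrs⇒IsCon : ∀ H b → b ∈ conAddrs H → IsCon H b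
∈conAddrs⇒IsCon (vcon P c ∷ H)  b (here refl) = P , c , refl
∈conAddrs⇒IsCon (vcon _ _ ∷ H)  b (there b∈) with ∈-map⁻ suc b∈
... | _ , b′∈ , refl = ∈conAddrs⇒IsCon H _ b′∈
∈conAddrs⇒IsCon (vunit ∷ H)     b b∈ with ∈-map⁻ suc b∈
... | _ , b′∈ , refl = ∈conAddrs⇒IsCon H _ b′∈
∈conAddrs⇒IsCon (vinj _ _ ∷ H)  b b∈ with ∈-map⁻ suc b∈
... | _ , b′∈ , refl = ∈conAddrs⇒IsCon H _ b′∈
∈conAddrs⇒IsCon (vpair _ _ ∷ H) b b∈ with ∈-map⁻ suc b∈
... | _ , b′∈ , refl = ∈conAddrs⇒IsCon H _ b′∈

-- Minimal dags by hash-consing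

mutual
  _≟ᵗʸ_ : DecidableEquality Ty
  unit    ≟ᵗʸ unit      = yes refl
  (s ⊕ t) ≟ᵗʸ (s′ ⊕ t′) = map′ (λ { (refl , refl) → refl }) (λ { refl → refl , refl }) (s ≟ᵗʸ s′ ×-dec t ≟ᵗʸ t′)
  (s ⊗ t) ≟ᵗʸ (s′ ⊗ t′) = map′ (λ { (refl , refl) → refl }) (λ { refl → refl , refl }) (s ≟ᵗʸ s′ ×-dec t ≟ᵗʸ t′)
  μ P     ≟ᵗʸ μ P′      = map′ (cong μ) (λ { refl → refl }) (P ≟ᵖᶠ P′)
  unit    ≟ᵗʸ (_ ⊕ _)   = no λ ()
  unit    ≟ᵗʸ (_ ⊗ _)   = no λ ()
  unit    ≟ᵗʸ μ _       = no λ ()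
  (_ ⊕ _) ≟ᵗʸ unit      = no λ ()
  (_ ⊕ _) ≟ᵗʸ (_ ⊗ _)   = no λ ()
  (_ ⊕ _) ≟ᵗʸ μ _       = no λ ()
  (_ ⊗ _) ≟ᵗʸ unit      = no λ ()
  (_ ⊗ _) ≟ᵗʸ (_ ⊕ _)   = no λ ()
  (_ ⊗ _) ≟ᵗʸ μ _       = no λ ()
  μ _     ≟ᵗʸ unit      = no λ ()
  μ _     ≟ᵗʸ (_ ⊕ _)   = no λ ()
  μ _     ≟ᵗʸ (_ ⊗ _)   = no λ ()

  _≟ᵖᶠ_ : DecidableEquality PF
  Id      ≟ᵖᶠ Id        = yes refl
  K s     ≟ᵖᶠ K s′      = map′ (cong K) (λ { refl → refl }) (s ≟ᵗʸ s′)
  (P ⊕ Q) ≟ᵖᶠ (P′ ⊕ Q′) = map′ (λ { (refl , refl) → refl }) (λ { refl → refl , refl }) (P ≟ᵖᶠ P′ ×-dec Q ≟ᵖᶠ Q′)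
  (P ⊗ Q) ≟ᵖᶠ (P′ ⊗ Q′) = map′ (λ { (refl , refl) → refl }) (λ { refl → refl , refl }) (P ≟ᵖᶠ P′ ×-dec Q ≟ᵖᶠ Q′)
  Id      ≟ᵖᶠ K _       = no λ ()
  Id      ≟ᵖᶠ (_ ⊕ _)   = no λ ()
  Id      ≟ᵖᶠ (_ ⊗ _)   = no λ ()
  K _     ≟ᵖᶠ Id        = no λ ()
  K _     ≟ᵖᶠ (_ ⊕ _)   = no λ ()
  K _     ≟ᵖᶠ (_ ⊗ _)   = no λ ()
  (_ ⊕ _) ≟ᵖᶠ Id        = no λ ()
  (_ ⊕ _) ≟ᵖᶠ K _       = no λ ()
  (_ ⊕ _) ≟ᵖᶠ (_ ⊗ _)   = no λ ()
  (_ ⊗ _) ≟ᵖᶠ Id        = no λ ()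
  (_ ⊗ _) ≟ᵖᶠ K _       = no λ ()
  (_ ⊗ _) ≟ᵖᶠ (_ ⊕ _)   = no λ ()

_≟ˢ_ : DecidableEquality Side
ι₁ ≟ˢ ι₁ = yes refl
ι₂ ≟ˢ ι₂ = yes refl
ι₁ ≟ˢ ι₂ = no λ ()
ι₂ ≟ˢ ι₁ = no λ ()

_≟ᵀ_ : DecidableEquality Tree
tunit       ≟ᵀ tunit         = yes refl
tinj s t    ≟ᵀ tinj s′ t′    = map′ (λ { (refl , refl) → refl }) (λ { refl → refl , refl }) (s ≟ˢ s′ ×-dec t ≟ᵀ t′)
tpair t u   ≟ᵀ tpair t′ u′   = map′ (λ { (refl , refl) → refl }) (λ { refl → refl , refl }) (t ≟ᵀ t′ ×-dec u ≟ᵀ u′)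
tcon P t    ≟ᵀ tcon P′ t′    = map′ (λ { (refl , refl) → refl }) (λ { refl → refl , refl }) (P ≟ᵖᶠ P′ ×-dec t ≟ᵀ t′)
tunit       ≟ᵀ tinj _ _      = no λ ()
tunit       ≟ᵀ tpair _ _     = no λ ()
tunit       ≟ᵀ tcon _ _      = no λ ()
tinj _ _    ≟ᵀ tunit         = no λ ()
tinj _ _    ≟ᵀ tpair _ _     = no λ ()
tinj _ _    ≟ᵀ tcon _ _      = no λ ()
tpair _ _   ≟ᵀ tunit         = no λ ()
tpair _ _   ≟ᵀ tinj _ _      = no λ ()
tpair _ _   ≟ᵀ tcon _ _      = no λ ()
tcon _ _    ≟ᵀ tunit         = no λ ()
tcon _ _    ≟ᵀ tinj _ _      = no λ ()
tcon _ _    ≟ᵀ tpair _ _     = no λ ()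

private
  clash : ∀ (H : Heap) a {v w} → H ! a ≡ just v → H ! a ≡ just w → v ≢ w → ∀ {X : Set} → X
  clash H a p q v≢w = ⊥-elim (v≢w (!-functional H a p q))

unfold-functional : ∀ {H a t t′} → Unfold H a t → Unfold H a t′ → t ≡ t′
unfold-functional {H} {a} (uunit _)     (uunit _)       = refl
unfold-functional {H} {a} (uinj p u)    (uinj q u′)     with !-functional H a p q
... | refl = cong (tinj _) (unfold-functional u u′)
unfold-functional {H} {a} (upair p u v) (upair q u′ v′) with !-functional H a p q
... | refl = cong₂ tpair (unfold-functional u u′) (unfold-functional v v′)
unfold-functional {H} {a} (ucon p u)    (ucon q u′)     with !-functional H a p q
... | refl = cong (tcon _) (unfold-functional u u′)
unfold-functional {H} {a} (uunit p)     (uinj q _)      = clash H a p q λ ()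
unfold-functional {H} {a} (uunit p)     (upair q _ _)   = clash H a p q λ ()
unfold-functional {H} {a} (uunit p)     (ucon q _)      = clash H a p q λ ()
unfold-functional {H} {a} (uinj p _)    (uunit q)       = clash H a p q λ ()
unfold-functional {H} {a} (uinj p _)    (upair q _ _)   = clash H a p q λ ()
unfold-functional {H} {a} (uinj p _)    (ucon q _)      = clash H a p q λ ()
unfold-functional {H} {a} (upair p _ _) (uunit q)       = clash H a p q λ ()
unfold-functional {H} {a} (upair p _ _) (uinj q _)      = clash H a p q λ ()
unfold-functional {H} {a} (upair p _ _) (ucon q _)      = clash H a p q λ ()
unfold-functional {H} {a} (ucon p _)    (uunit q)       = clash H a p q λ ()
unfold-functional {H} {a} (ucon p _)    (uinj q _)      = clash H a p q λ ()
unfold-functional {H} {a} (ucon p _)    (upair q _ _)   = clash H a p q λ ()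

unfold-⊑ : ∀ {H H′} → H ⊑ H′ → ∀ {a t} → Unfold H a t → Unfold H′ a t
unfold-⊑ ext (uunit p)     = uunit (⊑-lookup ext p)
unfold-⊑ ext (uinj p u)    = uinj (⊑-lookup ext p) (unfold-⊑ ext u)
unfold-⊑ ext (upair p u v) = upair (⊑-lookup ext p) (unfold-⊑ ext u) (unfold-⊑ ext v)
unfold-⊑ ext (ucon p u)    = ucon (⊑-lookup ext p) (unfold-⊑ ext u)

unfold⇒< : ∀ {H a t} → Unfold H a t → a < length H
unfold⇒< {H} {a} (uunit p)     = !-just⇒< H a p
unfold⇒< {H} {a} (uinj p _)    = !-just⇒< H a p
unfold⇒< {H} {a} (upair p _ _) = !-just⇒< H a p
unfold⇒< {H} {a} (ucon p _)    = !-just⇒< H a p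

unfold-exists : ∀ H → WF H → ∀ a → a < length H → ∃ (Unfold H a)
unfold-exists H wf a a< = go a a< (<-wellFounded a)
  where
  go : ∀ a → a < length H → Acc _<_ a → ∃ (Unfold H a)
  go a a< (acc below) with <⇒!-just H a a<
  ... | vunit , p = tunit , uunit p
  ... | vinj s b , p =
    let b<a = wf a _ b p cinj ; (t , u) = go b (<-trans b<a a<) (below b<a)
    in tinj s t , uinj p u
  ... | vpair b c , p =
    let b<a = wf a _ b p cpair₁ ; c<a = wf a _ c p cpair₂
        (t , u) = go b (<-trans b<a a<) (below b<a) ; (t′ , u′) = go c (<-trans c<a a<) (below c<a)
    in tpair t t′ , upair p u u′
  ... | vcon P b , p =
    let b<a = wf a _ b p ccon ; (t , u) = go b (<-trans b<a a<) (below b<a)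
    in tcon P t , ucon p u

unfold-IsCon : ∀ {H a t} → Unfold H a t → IsCon H a → ∃ λ P → ∃ λ t′ → t ≡ tcon P t′
unfold-IsCon {H} {a} (uunit p)     (_ , _ , q) = clash H a p q λ ()
unfold-IsCon {H} {a} (uinj p _)    (_ , _ , q) = clash H a p q λ ()
unfold-IsCon {H} {a} (upair p _ _) (_ , _ , q) = clash H a p q λ ()
unfold-IsCon         (ucon _ _)    _           = _ , _ , refl

data Subtree : Tree → Tree → Set where
  here   : ∀ {t} → Subtree t t
  inj    : ∀ {t u s} → Subtree t u → Subtree t (tinj s u)
  pair₁  : ∀ {t u w} → Subtree t u → Subtree t (tpair u w)
  pair₂  : ∀ {t u w} → Subtree t w → Subtree t (tpair u w)
  con    : ∀ {t u P} → Subtree t u → Subtree t (tcon P u)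

subtree-trans : ∀ {t u w} → Subtree t u → Subtree u w → Subtree t w
subtree-trans s here       = s
subtree-trans s (inj s′)   = inj (subtree-trans s s′)
subtree-trans s (pair₁ s′) = pair₁ (subtree-trans s s′)
subtree-trans s (pair₂ s′) = pair₂ (subtree-trans s s′)
subtree-trans s (con s′)   = con (subtree-trans s s′)

subtree-reach : ∀ {H x T S} → Unfold H x T → Subtree S T → ∃ λ y → Reach H x y × Unfold H y S
subtree-reach u here = _ , rrefl , u
subtree-reach (uinj p u) (inj s) with subtree-reach u s
... | y , r , u′ = y , rstep p cinj r , u′
subtree-reach (upair p u _) (pair₁ s) with subtree-reach u s
... | y , r , u′ = y , rstep p cpair₁ r , u′
subtree-reach (upair p _ u) (pair₂ s) with subtree-reach u s
... | y , r , u′ = y , rstep p cpair₂ r , u′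
subtree-reach (ucon p u) (con s) with subtree-reach u s
... | y , r , u′ = y , rstep p ccon r , u′

open import Data.List.Membership.DecPropositional _≟ᵀ_ using (_∈?_)

-- The maximally shared dag of T₀, built by hash-consing: one vertex per distinct subtree.
-- It has the fewest constructor vertices among all dags unfolding to T₀.
record HashConsed (T₀ : Tree) (Hc : Heap) (Ts : List Tree) : Set where
  field
    length≡  : length Hc ≡ length Ts
    unfolds  : ∀ i {S} → Ts ! i ≡ just S → Unfold Hc i S
    distinct : ∀ i j {S} → Ts ! i ≡ just S → Ts ! j ≡ just S → i ≡ j
    acyclic  : WF Hc
    subtrees : ∀ i {S} → Ts ! i ≡ just S → Subtree S T₀

hashConsed-[] : ∀ T₀ → HashConsed T₀ [] []
hashConsed-[] T₀ = record
  { length≡ = refl ; unfolds = λ _ () ; distinct = λ _ _ () ; acyclic = λ _ _ _ () ; subtrees = λ _ () }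

Interned : Tree → Tree → Heap → List Tree → Set
Interned T₀ t Hc Ts =
  ∃ λ Hc′ → ∃ λ Ts′ → HashConsed T₀ Hc′ Ts′ × Hc ⊑ Hc′ × Ts ⊑ Ts′ × ∃ λ i → Ts′ ! i ≡ just t

intern-vertex : ∀ {T₀ t Hc Ts} v → HashConsed T₀ Hc Ts → Subtree t T₀ →
                (∀ b → ChildOf v b → b < length Hc) → Unfold (Hc ∷ʳ v) (length Hc) t → Interned T₀ t Hc Ts
intern-vertex {T₀} {t} {Hc} {Ts} v hc t⊑T₀ children< unfolds-t with t ∈? Ts
... | yes t∈ = Hc , Ts , hc , ⊑-refl , ⊑-refl , ∈⇒! t∈
... | no t∉  = Hc ∷ʳ v , Ts ∷ʳ t , hc′ , ⊑-∷ʳ v , ⊑-∷ʳ t , length Ts , !-∷ʳ-length Ts t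
  where
  open HashConsed hc
  hc′ : HashConsed T₀ (Hc ∷ʳ v) (Ts ∷ʳ t)
  hc′ .HashConsed.length≡ = trans (length-∷ʳ Hc v) (trans (cong suc length≡) (sym (length-∷ʳ Ts t)))
  hc′ .HashConsed.unfolds i eq with !-∷ʳ⁻ Ts t i eq
  ... | inj₁ old          = unfold-⊑ (⊑-∷ʳ v) (unfolds i old)
  ... | inj₂ (refl , refl) = subst (λ k → Unfold (Hc ∷ʳ v) k t) length≡ unfolds-t
  hc′ .HashConsed.distinct i j p q with !-∷ʳ⁻ Ts t i p | !-∷ʳ⁻ Ts t j q
  ... | inj₁ p′           | inj₁ q′           = distinct i j p′ q′
  ... | inj₁ p′           | inj₂ (refl , refl) = ⊥-elim (t∉ (!⇒∈ Ts i p′))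
  ... | inj₂ (refl , refl) | inj₁ q′           = ⊥-elim (t∉ (!⇒∈ Ts j q′))
  ... | inj₂ (refl , refl) | inj₂ (refl , refl) = refl
  hc′ .HashConsed.acyclic = WF-∷ʳ {Hc} v acyclic children<
  hc′ .HashConsed.subtrees i eq with !-∷ʳ⁻ Ts t i eq
  ... | inj₁ old          = subtrees i old
  ... | inj₂ (refl , refl) = t⊑T₀

index<length : ∀ {T₀ Hc Ts S} → HashConsed T₀ Hc Ts → ∀ i → Ts ! i ≡ just S → i < length Hc
index<length {Ts = Ts} hc i p = subst (i <_) (sym (HashConsed.length≡ hc)) (!-just⇒< Ts i p)

intern : ∀ {T₀} t → Subtree t T₀ → ∀ {Hc Ts} → HashConsed T₀ Hc Ts → Interned T₀ t Hc Ts
intern tunit t⊑T₀ {Hc} hc = intern-vertex vunit hc t⊑T₀ (λ _ ()) (uunit (!-∷ʳ-length Hc vunit))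
intern (tinj s u) t⊑T₀ hc with intern u (subtree-trans (inj here) t⊑T₀) hc
... | Hc₁ , Ts₁ , hc₁ , e₁ , l₁ , j , p
  with intern-vertex (vinj s j) hc₁ t⊑T₀ (λ { _ cinj → index<length hc₁ j p })
         (uinj (!-∷ʳ-length Hc₁ _) (unfold-⊑ (⊑-∷ʳ _) (HashConsed.unfolds hc₁ j p)))
... | Hc₂ , Ts₂ , hc₂ , e₂ , l₂ , k , q = Hc₂ , Ts₂ , hc₂ , ⊑-trans e₁ e₂ , ⊑-trans l₁ l₂ , k , q
intern (tcon P u) t⊑T₀ hc with intern u (subtree-trans (con here) t⊑T₀) hc
... | Hc₁ , Ts₁ , hc₁ , e₁ , l₁ , j , p
  with intern-vertex (vcon P j) hc₁ t⊑T₀ (λ { _ ccon → index<length hc₁ j p })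
         (ucon (!-∷ʳ-length Hc₁ _) (unfold-⊑ (⊑-∷ʳ _) (HashConsed.unfolds hc₁ j p)))
... | Hc₂ , Ts₂ , hc₂ , e₂ , l₂ , k , q = Hc₂ , Ts₂ , hc₂ , ⊑-trans e₁ e₂ , ⊑-trans l₁ l₂ , k , q
intern (tpair u w) t⊑T₀ hc with intern u (subtree-trans (pair₁ here) t⊑T₀) hc
... | Hc₁ , Ts₁ , hc₁ , e₁ , l₁ , j , p with intern w (subtree-trans (pair₂ here) t⊑T₀) hc₁
... | Hc₂ , Ts₂ , hc₂ , e₂ , l₂ , j′ , p′
  with intern-vertex (vpair j j′) hc₂ t⊑T₀
         (λ { _ cpair₁ → index<length hc₂ j (⊑-lookup l₂ p) ; _ cpair₂ → index<length hc₂ j′ p′ })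
         (upair (!-∷ʳ-length Hc₂ _) (unfold-⊑ (⊑-∷ʳ _) (HashConsed.unfolds hc₂ j (⊑-lookup l₂ p)))
                                    (unfold-⊑ (⊑-∷ʳ _) (HashConsed.unfolds hc₂ j′ p′)))
... | Hc₃ , Ts₃ , hc₃ , e₃ , l₃ , k , q =
  Hc₃ , Ts₃ , hc₃ , ⊑-trans e₁ (⊑-trans e₂ e₃) , ⊑-trans l₁ (⊑-trans l₂ l₃) , k , q

module HashConsedDag {T : Tree} {Hc : Heap} {Ts : List Tree} (hc : HashConsed T Hc Ts)
                     (r : ℕ) (root-unfolds : Ts ! r ≡ just T) where
  open HashConsed hc

  private
    entry : ∀ i → i < length Hc → ∃ λ S → Ts ! i ≡ just S
    entry i i< = <⇒!-just Ts i (subst (i <_) length≡ i<)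

  reachable : ∀ b → b < length Hc → Reach Hc r b
  reachable b b< with entry b b<
  ... | S , pS with subtree-reach (unfolds r root-unfolds) (subtrees b pS)
  ... | y , r⇝y , uy with entry y (unfold⇒< uy)
  ... | S′ , pS′ with unfold-functional (unfolds y pS′) uy
  ... | refl with distinct y b pS′ pS
  ... | refl = r⇝y

  dag : Dag
  dag = record { heap = Hc ; root = r ; wf = acyclic ; rootOk = unfold⇒< (unfolds r root-unfolds) ; rooted = reachable }

  -- Each constructor vertex of Hc unfolds to a distinct subtree of T, which any dag for T
  -- must realise at a reachable constructor vertex of its own.
  countCon-≤ : ∀ {H x} → Unfold H x T → ∀ B → AllCons H x (_∈ B) → countCon Hc ≤ length B
  countCon-≤ {H} {x} uT B cons∈B =
    subst (_≤ length B) (length-conAddrs Hc) (length-≤-injection Realises (Unique-conAddrs Hc) image injective)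
    where
    Realises : ℕ → ℕ → Set
    Realises i y = ∃ λ S → Ts ! i ≡ just S × Unfold H y S

    image : ∀ {i} → i ∈ conAddrs Hc → ∃ λ y → Realises i y × y ∈ B
    image {i} i∈ with ∈conAddrs⇒IsCon Hc i i∈
    ... | isCon with entry i (IsCon⇒< Hc isCon)
    ... | S , pS with unfold-IsCon (unfolds i pS) isCon
    ... | P , t , refl with subtree-reach uT (subtrees i pS)
    ... | y , x⇝y , ucon p u = y , (_ , pS , ucon p u) , cons∈B y x⇝y (P , _ , p)

    injective : ∀ {i j y} → Realises i y → Realises j y → i ≡ j
    injective (S , p , u) (S′ , p′ , u′) with unfold-functional u u′
    ... | refl = distinct _ _ p p′

minSize : ∀ H a → WF H → a < length H →
          ∃ λ n → MinSize H a n × (∀ A → AllCons H a (_∈ A) → n ≤ length A)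
minSize H a wf a< with unfold-exists H wf a a<
... | T , uT with intern T here (hashConsed-[] T)
... | Hc , Ts , hc , _ , _ , r , pr =
  countCon Hc , ((dag , (T , uT , HashConsed.unfolds hc r pr) , refl) , minimal) , λ A → countCon-≤ uT A
  where
  open HashConsedDag hc r pr
  minimal : ∀ d → Bisim H a (heap d) (root d) → countCon Hc ≤ size d
  minimal d (T′ , uT′ , ud) with unfold-functional uT uT′
  ... | refl = subst (_ ≤_) (length-conAddrs (heap d))
                 (countCon-≤ ud (conAddrs (heap d)) λ b _ isCon → IsCon⇒∈conAddrs (heap d) b isCon)

minSize-unique : ∀ {H a n n′} → MinSize H a n → MinSize H a n′ → n ≡ n′
minSize-unique ((d , bis , refl) , min) ((d′ , bis′ , refl) , min′) = ≤-antisym (min d′ bis′) (min′ d bis)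

ClosedAbove : Heap → ℕ → Set
ClosedAbove H n = ∀ a v b → H ! a ≡ just v → ChildOf v b → n ≤ a → n ≤ b

ClosedAbove-length : ∀ H → ClosedAbove H (length H)
ClosedAbove-length H a v b eq _ |H|≤a = ⊥-elim (<⇒≱ (!-just⇒< H a eq) |H|≤a)

ClosedAbove-∷ʳ : ∀ {H n} v → ClosedAbove H n → (∀ b → ChildOf v b → n ≤ b) → ClosedAbove (H ∷ʳ v) n
ClosedAbove-∷ʳ {H} v closed new a w b eq child n≤a with !-∷ʳ⁻ H v a eq
... | inj₁ old           = closed a w b old child n≤a
... | inj₂ (refl , refl) = new b child

reach-ClosedAbove : ∀ {H n} → ClosedAbove H n → ∀ {a b} → n ≤ a → Reach H a b → n ≤ b
reach-ClosedAbove closed n≤a rrefl = n≤a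
reach-ClosedAbove closed n≤a (rstep {a} {v} {b} eq child r) =
  reach-ClosedAbove closed (closed a v b eq child n≤a) r

record NumeralIn (H H′ : Heap) (r n : ℕ) : Set where
  field
    added   : Heap
    heap≡   : H′ ≡ H ++ added
    added≤  : length added ≤ 3 * suc n
    acyclic : WF H′
    typed   : ValTy H′ r (μ natF)
    closed  : ClosedAbove H′ (length H)
    fresh   : length H ≤ r

  extends : H ⊑ H′
  extends = added , heap≡

  reach-fresh : ∀ b → Reach H′ r b → length H ≤ b
  reach-fresh b = reach-ClosedAbove closed fresh

numeral-spec : ∀ H n → WF H → NumeralIn H (proj₁ (numeral H n)) (proj₂ (numeral H n)) n
numeral-spec H zero wf = record
  { added   = vunit ∷ vinj ι₁ (length H) ∷ vcon natF (length H₁) ∷ []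
  ; heap≡   = trans (++-assoc H₁ _ _) (++-assoc H _ _)
  ; added≤  = ≤-refl
  ; acyclic = WF-∷ʳ {H₂} _ (WF-∷ʳ {H₁} _ (WF-∷ʳ {H} vunit wf λ _ ())
                 λ { _ cinj → ≤-reflexive (sym |H₁|) }) λ { _ ccon → ≤-reflexive (sym |H₂|) }
  ; typed   = tcon (!-∷ʳ-length H₂ _) (tinl (⊑-lookup (⊑-∷ʳ {xs = H₂} _) (!-∷ʳ-length H₁ _))
                 (tunit (⊑-lookup (⊑-trans (⊑-∷ʳ {xs = H₁} _) (⊑-∷ʳ {xs = H₂} _)) (!-∷ʳ-length H vunit))))
  ; closed  = ClosedAbove-∷ʳ {H₂} _ (ClosedAbove-∷ʳ {H₁} _ (ClosedAbove-∷ʳ {H} vunit (ClosedAbove-length H) λ _ ())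
                 λ { _ cinj → ≤-refl }) λ { _ ccon → ≤-trans (n≤1+n _) (≤-reflexive (sym |H₁|)) }
  ; fresh   = ≤-trans (n≤1+n _) (≤-trans (≤-reflexive (sym |H₁|)) (≤-trans (n≤1+n _) (≤-reflexive (sym |H₂|))))
  }
  where
  H₁ = H ∷ʳ vunit
  H₂ = H₁ ∷ʳ vinj ι₁ (length H)
  |H₁| : length H₁ ≡ suc (length H)
  |H₁| = length-∷ʳ H vunit
  |H₂| : length H₂ ≡ suc (length H₁)
  |H₂| = length-∷ʳ H₁ _
numeral-spec H (suc n) wf = record
  { added   = added ++ new
  ; heap≡   = trans (++-assoc H₁ _ _) (trans (cong (_++ new) heap≡) (++-assoc H added new))
  ; added≤  = ≤-trans (≤-reflexive (length-++ added)) (≤-trans (+-monoˡ-≤ 2 added≤) (arith n))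
  ; acyclic = WF-∷ʳ {H₂} _ (WF-∷ʳ {H₁} _ acyclic λ { _ cinj → ValTy⇒< typed })
                 λ { _ ccon → ≤-reflexive (sym (length-∷ʳ H₁ _)) }
  ; typed   = tcon (!-∷ʳ-length H₂ _) (tinr (⊑-lookup (⊑-∷ʳ {xs = H₂} _) (!-∷ʳ-length H₁ _))
                 (ValTy-⊑ (⊑-trans (⊑-∷ʳ {xs = H₁} _) (⊑-∷ʳ {xs = H₂} _)) typed))
  ; closed  = ClosedAbove-∷ʳ {H₂} _ (ClosedAbove-∷ʳ {H₁} _ closed λ { _ cinj → fresh })
                 λ { _ ccon → ⊑-length extends }
  ; fresh   = ≤-trans (⊑-length extends) (≤-trans (n≤1+n _) (≤-reflexive (sym (length-∷ʳ H₁ _))))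
  }
  where
  open NumeralIn (numeral-spec H n wf)
  H₁ = proj₁ (numeral H n)
  H₂ = H₁ ∷ʳ vinj ι₂ (proj₂ (numeral H n))
  new = vinj ι₂ (proj₂ (numeral H n)) ∷ vcon natF (length H₁) ∷ []
  arith : ∀ n → 3 * suc n + 2 ≤ 3 * suc (suc n)
  arith n = ≤-trans (m≤m+n _ 1) (≤-reflexive (eq n))
    where
    eq : ∀ n → 3 * suc n + 2 + 1 ≡ 3 * suc (suc n)
    eq = solve-∀

mutual
  eval-deterministic : ∀ {Γ t H} {ρ : Env Γ} {e : Term Γ t} {H₁ H₂ r₁ r₂ c₁ c₂} →
                       Eval H ρ e H₁ r₁ c₁ → Eval H ρ e H₂ r₂ c₂ → H₁ ≡ H₂ × r₁ ≡ r₂ × c₁ ≡ c₂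
  eval-deterministic e-var e-var = refl , refl , refl
  eval-deterministic e-unit e-unit = refl , refl , refl
  eval-deterministic e-lam e-lam = refl , refl , refl
  eval-deterministic (e-app d₁ d₂ d₃) (e-app d₁′ d₂′ d₃′) with eval-deterministic d₁ d₁′
  ... | refl , refl , refl with eval-deterministic d₂ d₂′
  ... | refl , refl , refl with eval-deterministic d₃ d₃′
  ... | refl , refl , refl = refl , refl , refl
  eval-deterministic (e-pair d₁ d₂) (e-pair d₁′ d₂′) with eval-deterministic d₁ d₁′
  ... | refl , refl , refl with eval-deterministic d₂ d₂′
  ... | refl , refl , refl = refl , refl , refl
  eval-deterministic (e-fst {H₁ = H₁} {a = a} d p) (e-fst d′ p′) with eval-deterministic d d′
  ... | refl , refl , refl with !-functional H₁ a p p′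
  ... | refl = refl , refl , refl
  eval-deterministic (e-snd {H₁ = H₁} {a = a} d p) (e-snd d′ p′) with eval-deterministic d d′
  ... | refl , refl , refl with !-functional H₁ a p p′
  ... | refl = refl , refl , refl
  eval-deterministic (e-inl d) (e-inl d′) with eval-deterministic d d′
  ... | refl , refl , refl = refl , refl , refl
  eval-deterministic (e-inr d) (e-inr d′) with eval-deterministic d d′
  ... | refl , refl , refl = refl , refl , refl
  eval-deterministic (e-case₁ {H₁ = H₁} {a = a} d p d₁) (e-case₁ d′ p′ d₁′) with eval-deterministic d d′
  ... | refl , refl , refl with !-functional H₁ a p p′
  ... | refl with eval-deterministic d₁ d₁′
  ... | refl , refl , refl = refl , refl , refl
  eval-deterministic (e-case₁ {H₁ = H₁} {a = a} d p _) (e-case₂ d′ p′ _) with eval-deterministic d d′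
  ... | refl , refl , refl with !-functional H₁ a p p′
  ... | ()
  eval-deterministic (e-case₂ {H₁ = H₁} {a = a} d p _) (e-case₁ d′ p′ _) with eval-deterministic d d′
  ... | refl , refl , refl with !-functional H₁ a p p′
  ... | ()
  eval-deterministic (e-case₂ {H₁ = H₁} {a = a} d p d₂) (e-case₂ d′ p′ d₂′) with eval-deterministic d d′
  ... | refl , refl , refl with !-functional H₁ a p p′
  ... | refl with eval-deterministic d₂ d₂′
  ... | refl , refl , refl = refl , refl , refl
  eval-deterministic (e-con d) (e-con d′) with eval-deterministic d d′
  ... | refl , refl , refl = refl , refl , refl
  eval-deterministic (e-scon d) (e-scon d′) with eval-deterministic d d′
  ... | refl , refl , refl = refl , refl , refl
  eval-deterministic (e-des {H₁ = H₁} {a = a} d p) (e-des d′ p′) with eval-deterministic d d′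
  ... | refl , refl , refl with !-functional H₁ a p p′
  ... | refl = refl , refl , refl
  eval-deterministic (e-sdes {H₁ = H₁} {a = a} d p) (e-sdes d′ p′) with eval-deterministic d d′
  ... | refl , refl , refl with !-functional H₁ a p p′
  ... | refl = refl , refl , refl
  eval-deterministic (e-fold d f) (e-fold d′ f′) with eval-deterministic d d′
  ... | refl , refl , refl with foldAt-deterministic f f′
  ... | refl , refl , refl , refl = refl , refl , refl
  eval-deterministic (e-toSafe d) (e-toSafe d′) with eval-deterministic d d′
  ... | refl , refl , refl = refl , refl , refl
  eval-deterministic (e-toNorm d) (e-toNorm d′) with eval-deterministic d d′
  ... | refl , refl , refl = refl , refl , refl
  eval-deterministic (e-cs d m) (e-cs d′ m′) with eval-deterministic d d′
  ... | refl , refl , refl with minSize-unique m m′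
  ... | refl = refl , refl , refl

  foldAt-deterministic : ∀ {Γ} {ρ : Env Γ} {P g e₀ H M a H₁ H₂ M₁ M₂ r₁ r₂ c₁ c₂} →
                         FoldAt ρ P g e₀ H M a H₁ M₁ r₁ c₁ → FoldAt ρ P g e₀ H M a H₂ M₂ r₂ c₂ →
                         H₁ ≡ H₂ × M₁ ≡ M₂ × r₁ ≡ r₂ × c₁ ≡ c₂
  foldAt-deterministic (f-hit p) (f-hit q) with trans (sym p) q
  ... | refl = refl , refl , refl , refl
  foldAt-deterministic (f-hit p) (f-miss q _ _ _) with trans (sym p) q
  ... | ()
  foldAt-deterministic (f-miss q _ _ _) (f-hit p) with trans (sym p) q
  ... | ()
  foldAt-deterministic {H = H} {a = a} (f-miss _ p m d) (f-miss _ p′ m′ d′) with !-functional H a p p′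
  ... | refl with pmap-deterministic m m′
  ... | refl , refl , refl , refl with eval-deterministic d d′
  ... | refl , refl , refl = refl , refl , refl , refl

  pmap-deterministic : ∀ {Γ} {ρ : Env Γ} {P g e₀ Q H M b H₁ H₂ M₁ M₂ r₁ r₂ c₁ c₂} →
                       PMap ρ P g e₀ Q H M b H₁ M₁ r₁ c₁ → PMap ρ P g e₀ Q H M b H₂ M₂ r₂ c₂ →
                       H₁ ≡ H₂ × M₁ ≡ M₂ × r₁ ≡ r₂ × c₁ ≡ c₂
  pmap-deterministic (p-id f) (p-id f′) with foldAt-deterministic f f′
  ... | refl , refl , refl , refl = refl , refl , refl , refl
  pmap-deterministic p-K p-K = refl , refl , refl , refl
  pmap-deterministic {H = H} {b = b} (p-sum p m) (p-sum p′ m′) with !-functional H b p p′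
  ... | refl with pmap-deterministic m m′
  ... | refl , refl , refl , refl = refl , refl , refl , refl
  pmap-deterministic {H = H} {b = b} (p-prod p m n) (p-prod p′ m′ n′) with !-functional H b p p′
  ... | refl with pmap-deterministic m m′
  ... | refl , refl , refl , refl with pmap-deterministic n n′
  ... | refl , refl , refl , refl = refl , refl , refl , refl

-- The logical relation

fresh : ℕ → Heap → List ℕ
fresh n []      = []
fresh n (_ ∷ X) = n ∷ fresh (suc n) X

length-fresh : ∀ n X → length (fresh n X) ≡ length X
length-fresh n []      = refl
length-fresh n (_ ∷ X) = cong suc (length-fresh (suc n) X)

fresh-++ : ∀ n X Y → fresh n (X ++ Y) ≡ fresh n X ++ fresh (n + length X) Y
fresh-++ n []      Y = cong (λ m → fresh m Y) (sym (+-identityʳ n))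
fresh-++ n (_ ∷ X) Y = cong (n ∷_) (trans (fresh-++ (suc n) X Y) (cong (λ m → fresh (suc n) X ++ fresh m Y) (sym (+-suc n (length X)))))

∈-fresh⁺ : ∀ n X {b} → n ≤ b → b < n + length X → b ∈ fresh n X
∈-fresh⁺ n []      n≤b b< = ⊥-elim (<⇒≱ b< (≤-trans (≤-reflexive (+-identityʳ n)) n≤b))
∈-fresh⁺ n (_ ∷ X) {b} n≤b b< with n ≟ b
... | yes refl = here refl
... | no n≢b   = there (∈-fresh⁺ (suc n) X (≤∧≢⇒< n≤b n≢b) (≤-trans b< (≤-reflexive (+-suc n (length X)))))

grow : List ℕ → Heap → Heap → List ℕ
grow A H X = A ++ fresh (length H) X

length-grow : ∀ A H X → length (grow A H X) ≡ length A + length X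
length-grow A H X = trans (length-++ A) (cong (length A +_) (length-fresh (length H) X))

grow-++ : ∀ A H X Y → grow (grow A H X) (H ++ X) Y ≡ grow A H (X ++ Y)
grow-++ A H X Y = begin
  (A ++ fresh (length H) X) ++ fresh (length (H ++ X)) Y    ≡⟨ ++-assoc A _ _ ⟩
  A ++ (fresh (length H) X ++ fresh (length (H ++ X)) Y)    ≡⟨ cong (λ n → A ++ (fresh (length H) X ++ fresh n Y)) (length-++ H) ⟩
  A ++ (fresh (length H) X ++ fresh (length H + length X) Y) ≡⟨ cong (A ++_) (sym (fresh-++ (length H) X Y)) ⟩
  A ++ fresh (length H) (X ++ Y)                            ∎
  where open ≡-Reasoning

grow-⊆ : ∀ A H X Y → grow A H X ⊆ᴸ grow A H (X ++ Y)
grow-⊆ A H X Y = ⊆-trans (xs⊆xs++ys _ (fresh (length (H ++ X)) Y)) (⊆-reflexive (grow-++ A H X Y))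

∈-grow : ∀ A H X {b} → length H ≤ b → b < length (H ++ X) → b ∈ grow A H X
∈-grow A H X H≤b b< = ∈-++⁺ʳ A (∈-fresh⁺ (length H) X H≤b (≤-trans b< (≤-reflexive (length-++ H))))

∈-grow-∷ʳ : ∀ A H X v → length (H ++ X) ∈ grow A H (X ∷ʳ v)
∈-grow-∷ʳ A H X v = ∈-grow A H (X ∷ʳ v) (⊑-length {xs = H} (X , refl))
  (subst (length (H ++ X) <_) (cong length (++-assoc H X [ v ])) (length-∷ʳ≥ (H ++ X)))

-- Predicates on addresses are given by syntax, so that the logical relation below,
-- which quantifies over them, stays in Set.
data Region : Set where
  everywhere : Region
  _∪≥_       : Region → ℕ → Region
  _∩_        : List ℕ → Region → Region

⟪_⟫ : Region → ℕ → Set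
⟪ everywhere ⟫ b = ⊤
⟪ F ∪≥ n ⟫     b = ⟪ F ⟫ b ⊎ n ≤ b
⟪ A ∩ F ⟫      b = b ∈ A × ⟪ F ⟫ b

_⊆ᴿ_ : Region → Region → Set
F ⊆ᴿ F′ = ∀ b → ⟪ F ⟫ b → ⟪ F′ ⟫ b

∪≥-⊆ : ∀ F n → F ⊆ᴿ (F ∪≥ n)
∪≥-⊆ F n b = inj₁

∪≥-absorb : ∀ F {n m} → n ≤ m → ((F ∪≥ n) ∪≥ m) ⊆ᴿ (F ∪≥ n)
∪≥-absorb F n≤m b (inj₁ p)   = p
∪≥-absorb F n≤m b (inj₂ m≤b) = inj₂ (≤-trans n≤m m≤b)

-- The budget A contains the constructor vertices of the normal data; safe data are unconstrained.
Value : Heap → List ℕ → GTy → ℕ → Set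
Value H A (unit m)  a = H ! a ≡ just vunit
Value H A (μ nrm P) a = ValTy H a (μ P) × AllCons H a (_∈ A)
Value H A (μ sfe P) a = ValTy H a (μ P)
Value H A (g ⊕ h)   a = ∃ λ b → (H ! a ≡ just (vinj ι₁ b) × Value H A g b) ⊎ (H ! a ≡ just (vinj ι₂ b) × Value H A h b)
Value H A (g ⊗ h)   a = ∃ λ b → ∃ λ c → H ! a ≡ just (vpair b c) × Value H A g b × Value H A h c

Value⇒< : ∀ {H A} g {a} → Value H A g a → a < length H
Value⇒< {H} (unit m)  {a} p                  = !-just⇒< H a p
Value⇒<     (μ nrm P)     (v , _)            = ValTy⇒< v
Value⇒<     (μ sfe P)     v                  = ValTy⇒< v
Value⇒< {H} (g ⊕ h)   {a} (_ , inj₁ (p , _)) = !-just⇒< H a p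
Value⇒< {H} (g ⊕ h)   {a} (_ , inj₂ (p , _)) = !-just⇒< H a p
Value⇒< {H} (g ⊗ h)   {a} (_ , _ , p , _)    = !-just⇒< H a p

Value-⊑ : ∀ {H H′ A} → WF H → H ⊑ H′ → ∀ g {a} → Value H A g a → Value H′ A g a
Value-⊑ wf ext (unit m)  p                      = ⊑-lookup ext p
Value-⊑ wf ext (μ nrm P) (v , cons)             = ValTy-⊑ ext v , AllCons-⊑ wf ext (ValTy⇒< v) cons
Value-⊑ wf ext (μ sfe P) v                      = ValTy-⊑ ext v
Value-⊑ wf ext (g ⊕ h)   (b , inj₁ (p , v))     = b , inj₁ (⊑-lookup ext p , Value-⊑ wf ext g v)
Value-⊑ wf ext (g ⊕ h)   (b , inj₂ (p , v))     = b , inj₂ (⊑-lookup ext p , Value-⊑ wf ext h v)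
Value-⊑ wf ext (g ⊗ h)   (b , c , p , v , w)    = b , c , ⊑-lookup ext p , Value-⊑ wf ext g v , Value-⊑ wf ext h w

Value-mono : ∀ {H A A′} → A ⊆ᴸ A′ → ∀ g {a} → Value H A g a → Value H A′ g a
Value-mono A⊆ (unit m)  p                   = p
Value-mono A⊆ (μ nrm P) (v , cons)          = v , AllCons-mono (λ _ → A⊆) cons
Value-mono A⊆ (μ sfe P) v                   = v
Value-mono A⊆ (g ⊕ h)   (b , inj₁ (p , v))  = b , inj₁ (p , Value-mono A⊆ g v)
Value-mono A⊆ (g ⊕ h)   (b , inj₂ (p , v))  = b , inj₂ (p , Value-mono A⊆ h v)
Value-mono A⊆ (g ⊗ h)   (b , c , p , v , w) = b , c , p , Value-mono A⊆ g v , Value-mono A⊆ h w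

Value⇒ValTy : ∀ {H A} g {a} → Value H A g a → ValTy H a (erase g)
Value⇒ValTy (unit m)  p                   = tunit p
Value⇒ValTy (μ nrm P) (v , _)             = v
Value⇒ValTy (μ sfe P) v                   = v
Value⇒ValTy (g ⊕ h)   (b , inj₁ (p , v))  = tinl p (Value⇒ValTy g v)
Value⇒ValTy (g ⊕ h)   (b , inj₂ (p , v))  = tinr p (Value⇒ValTy h v)
Value⇒ValTy (g ⊗ h)   (b , c , p , v , w) = tpair p (Value⇒ValTy g v) (Value⇒ValTy h w)

ValTy⇒Value : ∀ {H A} g {a} → ValTy H a (erase g) → AllCons H a (_∈ A) → Value H A g a
ValTy⇒Value (unit m)  (tunit p)     cons = p
ValTy⇒Value (μ nrm P) v             cons = v , cons
ValTy⇒Value (μ sfe P) v             cons = v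
ValTy⇒Value (g ⊕ h)   (tinl p v)    cons = _ , inj₁ (p , ValTy⇒Value g v (AllCons-child p cinj cons))
ValTy⇒Value (g ⊕ h)   (tinr p v)    cons = _ , inj₂ (p , ValTy⇒Value h v (AllCons-child p cinj cons))
ValTy⇒Value (g ⊗ h)   (tpair p v w) cons =
  _ , _ , p , ValTy⇒Value g v (AllCons-child p cpair₁ cons) , ValTy⇒Value h w (AllCons-child p cpair₂ cons)

ValTy⇒Value-S : ∀ {H A} g {a} → ValTy H a (erase g) → Value H A (S g) a
ValTy⇒Value-S (unit m)  (tunit p)     = p
ValTy⇒Value-S (μ m P)   v             = v
ValTy⇒Value-S (g ⊕ h)   (tinl p v)    = _ , inj₁ (p , ValTy⇒Value-S g v)
ValTy⇒Value-S (g ⊕ h)   (tinr p v)    = _ , inj₂ (p , ValTy⇒Value-S h v)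
ValTy⇒Value-S (g ⊗ h)   (tpair p v w) = _ , _ , p , ValTy⇒Value-S g v , ValTy⇒Value-S h w

erase-S : ∀ g → erase (S g) ≡ erase g
erase-S (unit m) = refl
erase-S (μ m P)  = refl
erase-S (g ⊕ h)  = cong₂ _⊕_ (erase-S g) (erase-S h)
erase-S (g ⊗ h)  = cong₂ _⊗_ (erase-S g) (erase-S h)

erase-N : ∀ g → erase (N g) ≡ erase g
erase-N (unit m) = refl
erase-N (μ m P)  = refl
erase-N (g ⊕ h)  = cong₂ _⊕_ (erase-N g) (erase-N h)
erase-N (g ⊗ h)  = cong₂ _⊗_ (erase-N g) (erase-N h)

erase-⌈⌉ : ∀ s → erase ⌈ s ⌉ ≡ s
erase-⌈⌉ unit    = refl
erase-⌈⌉ (s ⊕ t) = cong₂ _⊕_ (erase-⌈⌉ s) (erase-⌈⌉ t)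
erase-⌈⌉ (s ⊗ t) = cong₂ _⊗_ (erase-⌈⌉ s) (erase-⌈⌉ t)
erase-⌈⌉ (μ P)   = refl

erase-Papp : ∀ P g → erase (Papp P g) ≡ PappTy P (erase g)
erase-Papp Id      g = refl
erase-Papp (K s)   g = erase-⌈⌉ s
erase-Papp (P ⊕ Q) g = cong₂ _⊕_ (erase-Papp P g) (erase-Papp Q g)
erase-Papp (P ⊗ Q) g = cong₂ _⊗_ (erase-Papp P g) (erase-Papp Q g)

Value-S : ∀ {H A} g {a} → Value H A g a → Value H A (S g) a
Value-S g v = ValTy⇒Value-S g (Value⇒ValTy g v)

Value-S-any : ∀ {H A B} g {a} → Value H A (S g) a → Value H B (S g) a
Value-S-any g v = ValTy⇒Value-S g (subst (ValTy _ _) (erase-S g) (Value⇒ValTy (S g) v))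

Value-normal⇒AllCons : ∀ {H A} g {a} → NormalG g → Value H A g a → AllCons H a (_∈ A)
Value-normal⇒AllCons (unit nrm) _ p = AllCons-nonCon p (λ _ _ ()) λ _ ()
Value-normal⇒AllCons (μ nrm P) _ (_ , cons) = cons
Value-normal⇒AllCons (g ⊕ h) (ng , nh) (b , inj₁ (p , v)) =
  AllCons-nonCon p (λ _ _ ()) λ { _ cinj → Value-normal⇒AllCons g ng v }
Value-normal⇒AllCons (g ⊕ h) (ng , nh) (b , inj₂ (p , v)) =
  AllCons-nonCon p (λ _ _ ()) λ { _ cinj → Value-normal⇒AllCons h nh v }
Value-normal⇒AllCons (g ⊗ h) (ng , nh) (b , c , p , v , w) =
  AllCons-nonCon p (λ _ _ ()) λ { _ cpair₁ → Value-normal⇒AllCons g ng v ; _ cpair₂ → Value-normal⇒AllCons h nh w }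

Normal-⌈⌉ : ∀ s → NormalG ⌈ s ⌉
Normal-⌈⌉ unit    = tt
Normal-⌈⌉ (s ⊕ t) = Normal-⌈⌉ s , Normal-⌈⌉ t
Normal-⌈⌉ (s ⊗ t) = Normal-⌈⌉ s , Normal-⌈⌉ t
Normal-⌈⌉ (μ P)   = tt

Normal-Papp : ∀ Q P → NormalG (Papp Q (μ nrm P))
Normal-Papp Id      P = tt
Normal-Papp (K s)   P = Normal-⌈⌉ s
Normal-Papp (Q ⊕ R) P = Normal-Papp Q P , Normal-Papp R P
Normal-Papp (Q ⊗ R) P = Normal-Papp Q P , Normal-Papp R P

EnvVal : Heap → List ℕ → (ℕ → Set) → (Γ : Ctx) → Env Γ → Set
EnvVal H A F []      []      = ⊤
EnvVal H A F (g ∷ Γ) (a ∷ ρ) = (Value H A g a × AllCons H a F) × EnvVal H A F Γ ρ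

EnvVal-lookup : ∀ {H A F Γ g} (ρ : Env Γ) → EnvVal H A F Γ ρ → (x : Γ ∋ g) →
                Value H A g (lookupEnv ρ x) × AllCons H (lookupEnv ρ x) F
EnvVal-lookup (a ∷ ρ) (v , _)  here      = v
EnvVal-lookup (a ∷ ρ) (_ , vs) (there x) = EnvVal-lookup ρ vs x

EnvVal-mono : ∀ {H H′ A A′} {F F′ : ℕ → Set} → WF H → H ⊑ H′ → A ⊆ᴸ A′ → (∀ b → F b → F′ b) →
              ∀ Γ (ρ : Env Γ) → EnvVal H A F Γ ρ → EnvVal H′ A′ F′ Γ ρ
EnvVal-mono wf ext A⊆ F⊆ []      []      tt = tt
EnvVal-mono wf ext A⊆ F⊆ (g ∷ Γ) (a ∷ ρ) ((v , cons) , vs) =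
  (Value-⊑ wf ext g (Value-mono A⊆ g v) , AllCons-⊑ wf ext (Value⇒< g v) (AllCons-mono F⊆ cons)) ,
  EnvVal-mono wf ext A⊆ F⊆ Γ ρ vs

EnvVal-restrict : ∀ {H A F Δ Γ} (s : Δ ⊆ Γ) (ρ : Env Γ) → EnvVal H A F Γ ρ → EnvVal H A F Δ (restrict s ρ)
EnvVal-restrict done     []      tt       = tt
EnvVal-restrict (keep s) (a ∷ ρ) (v , vs) = v , EnvVal-restrict s ρ vs
EnvVal-restrict (drop s) (a ∷ ρ) (_ , vs) = EnvVal-restrict s ρ vs

EnvVal-normal : ∀ {H A F} Δ (ρ : Env Δ) → All NormalG Δ → EnvVal H A F Δ ρ → EnvVal H A (λ b → b ∈ A × F b) Δ ρ
EnvVal-normal []      []      []         tt = tt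
EnvVal-normal (g ∷ Δ) (a ∷ ρ) (ng ∷ nΔ) ((v , cons) , vs) =
  (v , λ b r c → Value-normal⇒AllCons g ng v b r c , cons b r c) , EnvVal-normal Δ ρ nΔ vs

-- for each arrow: a cost and a growth bound for the body, as polynomials in the budget size at the call
Bounds : Type → Set
Bounds (gr g)  = ⊤
Bounds (g ⇒ t) = PolyExpr × PolyExpr × Bounds t

_≤ᴮ_ : ∀ {t} → Bounds t → Bounds t → Set
_≤ᴮ_ {gr g}  _           _              = ⊤
_≤ᴮ_ {g ⇒ t} (c , p , b) (c′ , p′ , b′) =
  (∀ n → ⟦ c ⟧ n ≤ ⟦ c′ ⟧ n) × (∀ n → ⟦ p ⟧ n ≤ ⟦ p′ ⟧ n) × b ≤ᴮ b′

_⊔ᴮ_ : ∀ {t} → Bounds t → Bounds t → Bounds t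
_⊔ᴮ_ {gr g}  _           _              = tt
_⊔ᴮ_ {g ⇒ t} (c , p , b) (c′ , p′ , b′) = c ⊞ c′ , p ⊞ p′ , b ⊔ᴮ b′

≤ᴮ-⊔ᴮˡ : ∀ {t} (b b′ : Bounds t) → b ≤ᴮ (b ⊔ᴮ b′)
≤ᴮ-⊔ᴮˡ {gr g}  _           _              = tt
≤ᴮ-⊔ᴮˡ {g ⇒ t} (c , p , b) (c′ , p′ , b′) = (λ _ → m≤m+n _ _) , (λ _ → m≤m+n _ _) , ≤ᴮ-⊔ᴮˡ b b′

≤ᴮ-⊔ᴮʳ : ∀ {t} (b b′ : Bounds t) → b′ ≤ᴮ (b ⊔ᴮ b′)
≤ᴮ-⊔ᴮʳ {gr g}  _           _              = tt
≤ᴮ-⊔ᴮʳ {g ⇒ t} (c , p , b) (c′ , p′ , b′) = (λ _ → m≤n+m _ _) , (λ _ → m≤n+m _ _) , ≤ᴮ-⊔ᴮʳ b b′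

record Good {Γ t} (Rel : Heap → List ℕ → Region → Val t → Set) (H : Heap) (A : List ℕ) (F : Region)
            (ρ : Env Γ) (e : Term Γ t) (pc pg : PolyExpr) : Set where
  constructor good
  field
    heap′     : Heap
    result    : Val t
    cost      : ℕ
    evaluates : Eval H ρ e heap′ result cost
    cost≤     : cost ≤ ⟦ pc ⟧ (length A)
    new       : Heap
    heap≡     : heap′ ≡ H ++ new
    new≤      : length new ≤ ⟦ pg ⟧ (length A)
    acyclic   : WF heap′
    related   : Rel heap′ (grow A H new) (F ∪≥ length H) result

Related : (t : Type) → Bounds t → Heap → List ℕ → Region → Val t → Set
Related (gr g)  _              H A F (addr a)   = Value H A g a × AllCons H a ⟪ F ⟫
Related (g ⇒ t) (pc , pg , bd) H A F (clo ρ′ b) =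
  ∀ H′ A′ F′ a → H ⊑ H′ → A ⊆ᴸ A′ → F ⊆ᴿ F′ → WF H′ → Value H′ A′ g a → AllCons H′ a ⟪ F′ ⟫ →
  Good (Related t bd) H′ A′ F′ (a ∷ ρ′) b pc pg

Related-mono : ∀ t bd {H H′ A A′ F F′} v → WF H → H ⊑ H′ → A ⊆ᴸ A′ → F ⊆ᴿ F′ →
               Related t bd H A F v → Related t bd H′ A′ F′ v
Related-mono (gr g) bd (addr a) wf ext A⊆ F⊆ (v , cons) =
  Value-⊑ wf ext g (Value-mono A⊆ g v) , AllCons-⊑ wf ext (Value⇒< g v) (AllCons-mono F⊆ cons)
Related-mono (g ⇒ t) bd (clo ρ′ b) wf ext A⊆ F⊆ f H″ A″ F″ a ext′ A⊆′ F⊆′ =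
  f H″ A″ F″ a (⊑-trans ext ext′) (⊆-trans A⊆ A⊆′) (λ b p → F⊆′ b (F⊆ b p))

Related-≤ᴮ : ∀ t {bd bd′ H A F} v → bd ≤ᴮ bd′ → Related t bd H A F v → Related t bd′ H A F v
Related-≤ᴮ (gr g) (addr a) _ r = r
Related-≤ᴮ (g ⇒ t) {c , p , bd} {c′ , p′ , bd′} (clo ρ′ e) (c≤ , p≤ , bd≤) f H′ A′ F′ a ext A⊆ F⊆ wf v cons
  with f H′ A′ F′ a ext A⊆ F⊆ wf v cons
... | good H″ r cost ev cost≤ X eq X≤ wf′ rel =
  good H″ r cost ev (≤-trans cost≤ (c≤ _)) X eq (≤-trans X≤ (p≤ _)) wf′ (Related-≤ᴮ t r bd≤ rel)

record Bound (t : Type) : Set where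
  constructor ⟨_,_,_⟩
  field
    cost growth : PolyExpr
    val         : Bounds t
open Bound

-- cost and allocation of the functorial map of P at one vertex, not counting the recursive folds
overhead : PF → ℕ
overhead Id      = 2
overhead (K _)   = 1
overhead (P ⊕ Q) = suc (overhead P + overhead Q)
overhead (P ⊗ Q) = suc (overhead P + overhead Q)

-- after a subterm with growth bound p, the budget has size at most 𝕏 + p
after : PolyExpr → PolyExpr
after p = 𝕏 ⊞ p

bound : ∀ {Γ t} → Term Γ t → Bound t
bound (var x)     = ⟨ ⌜ 1 ⌝ , ⌜ 0 ⌝ , tt ⟩
bound unit        = ⟨ ⌜ 1 ⌝ , ⌜ 1 ⌝ , tt ⟩
bound (lam e)     = ⟨ ⌜ 1 ⌝ , ⌜ 0 ⌝ , (cost (bound e) , growth (bound e) , val (bound e)) ⟩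
bound (app e₁ e₂) =
  let ⟨ c₁ , g₁ , (cb , gb , vb) ⟩ = bound e₁ ; ⟨ c₂ , g₂ , _ ⟩ = bound e₂
      m₂ = after (g₁ ⊞ (g₂ ∘ₚ after g₁))
  in ⟨ ⌜ 1 ⌝ ⊞ c₁ ⊞ (c₂ ∘ₚ after g₁) ⊞ (cb ∘ₚ m₂) , g₁ ⊞ ((g₂ ∘ₚ after g₁) ⊞ (gb ∘ₚ m₂)) , vb ⟩
bound (pair e₁ e₂) =
  let ⟨ c₁ , g₁ , _ ⟩ = bound e₁ ; ⟨ c₂ , g₂ , _ ⟩ = bound e₂
  in ⟨ ⌜ 1 ⌝ ⊞ c₁ ⊞ (c₂ ∘ₚ after g₁) , g₁ ⊞ (g₂ ∘ₚ after g₁) ⊞ ⌜ 1 ⌝ , tt ⟩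
bound (fst e)     = ⟨ ⌜ 1 ⌝ ⊞ cost (bound e) , growth (bound e) , tt ⟩
bound (snd e)     = ⟨ ⌜ 1 ⌝ ⊞ cost (bound e) , growth (bound e) , tt ⟩
bound (inl e)     = ⟨ ⌜ 1 ⌝ ⊞ cost (bound e) , growth (bound e) ⊞ ⌜ 1 ⌝ , tt ⟩
bound (inr e)     = ⟨ ⌜ 1 ⌝ ⊞ cost (bound e) , growth (bound e) ⊞ ⌜ 1 ⌝ , tt ⟩
bound (case e _ e₁ e₂) =
  let ⟨ c , g , _ ⟩ = bound e ; ⟨ c₁ , g₁ , v₁ ⟩ = bound e₁ ; ⟨ c₂ , g₂ , v₂ ⟩ = bound e₂
  in ⟨ ⌜ 1 ⌝ ⊞ c ⊞ ((c₁ ⊞ c₂) ∘ₚ after g) , g ⊞ ((g₁ ⊞ g₂) ∘ₚ after g) , v₁ ⊔ᴮ v₂ ⟩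
bound (con P e)   = ⟨ ⌜ 1 ⌝ ⊞ cost (bound e) , growth (bound e) ⊞ ⌜ 1 ⌝ , tt ⟩
bound (des P e)   = ⟨ ⌜ 1 ⌝ ⊞ cost (bound e) , growth (bound e) , tt ⟩
bound (scon P e)  = ⟨ ⌜ 1 ⌝ ⊞ cost (bound e) , growth (bound e) ⊞ ⌜ 1 ⌝ , tt ⟩
bound (sdes P e)  = ⟨ ⌜ 1 ⌝ ⊞ cost (bound e) , growth (bound e) , tt ⟩
bound (fold P g e₀ e₁) =
  let ⟨ c₀ , g₀ , _ ⟩ = bound e₀ ; ⟨ c₁ , g₁ , _ ⟩ = bound e₁
      perVertex : PolyExpr → PolyExpr
      perVertex p = (⌜ overhead P ⌝ ⊞ (p ∘ₚ after g₁)) ⊠ after g₁ ⊞ ⌜ 1 ⌝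
  in ⟨ ⌜ 1 ⌝ ⊞ c₁ ⊞ perVertex c₀ , g₁ ⊞ perVertex g₀ , tt ⟩
bound (toSafe e)     = ⟨ ⌜ 1 ⌝ ⊞ cost (bound e) , growth (bound e) , tt ⟩
bound (toNorm _ _ e) = ⟨ ⌜ 1 ⌝ ⊞ cost (bound e) , growth (bound e) , tt ⟩
bound (cs P e)       = ⟨ ⌜ 1 ⌝ ⊞ cost (bound e) , growth (bound e) ⊞ ⌜ 3 ⌝ ⊠ (after (growth (bound e)) ⊞ ⌜ 1 ⌝) , tt ⟩

Sound : ∀ {Γ t} → Term Γ t → Set
Sound {Γ} {t} e = ∀ H (ρ : Env Γ) A F → WF H → EnvVal H A ⟪ F ⟫ Γ ρ →
                  Good (Related t (val (bound e))) H A F ρ e (cost (bound e)) (growth (bound e))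

keys : Memo → List ℕ
keys = map proj₁

lookupM-nothing⇒∉ : ∀ M k → lookupM M k ≡ nothing → k ∉ keys M
lookupM-nothing⇒∉ ((b , r) ∷ M) k eq k∈ with k ≡ᵇ b in k≡ᵇb
lookupM-nothing⇒∉ ((b , r) ∷ M) k () k∈          | true
lookupM-nothing⇒∉ ((b , r) ∷ M) k eq (here refl) | false = subst T k≡ᵇb (≡⇒≡ᵇ k k refl)
lookupM-nothing⇒∉ ((b , r) ∷ M) k eq (there k∈)  | false = lookupM-nothing⇒∉ M k eq k∈

lookupM-∷ : ∀ M k x r {r′} → lookupM ((x , r) ∷ M) k ≡ just r′ → r ≡ r′ ⊎ lookupM M k ≡ just r′
lookupM-∷ M k x r eq with k ≡ᵇ x
... | true  = inj₁ (just-injective eq)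
... | false = inj₂ eq

length-++-≤ : ∀ {A : Set} (xs ys : List A) {m n} → length xs ≤ m → length ys ≤ n → length (xs ++ ys) ≤ m + n
length-++-≤ xs ys xs≤ ys≤ = ≤-trans (≤-reflexive (length-++ xs)) (+-mono-≤ xs≤ ys≤)

keys-++⁻ : ∀ xs ys {k} → k ∈ keys (xs ++ ys) → k ∈ keys xs ⊎ k ∈ keys ys
keys-++⁻ xs ys k∈ = ∈-++⁻ (keys xs) (subst (_ ∈_) (map-++ proj₁ xs ys) k∈)

slack-suc : ∀ n {c s s′} → c ≤ n + s → s ≤ s′ → suc c ≤ n + suc s′
slack-suc n c≤ s≤s′ = ≤-trans (s≤s (≤-trans c≤ (+-monoʳ-≤ n s≤s′))) (≤-reflexive (sym (+-suc n _)))

slack-prod : ∀ m {k₁ k₂ k s₁ s₂ c₁ c₂} → k ≡ k₂ + k₁ → c₁ ≤ m * k₁ + s₁ → c₂ ≤ m * k₂ + s₂ →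
             suc (c₁ + c₂) ≤ m * k + suc (s₁ + s₂)
slack-prod m {k₁} {k₂} {s₁ = s₁} {s₂} refl c₁≤ c₂≤ =
  ≤-trans (s≤s (+-mono-≤ c₁≤ c₂≤)) (≤-reflexive (shuffle m k₁ k₂ s₁ s₂))
  where
  shuffle : ∀ m k₁ k₂ s₁ s₂ → suc (m * k₁ + s₁ + (m * k₂ + s₂)) ≡ m * (k₂ + k₁) + suc (s₁ + s₂)
  shuffle = solve-∀

-- one memo entry costs o for the functorial map plus C for the body
slack-miss : ∀ o C k {c₁ c₂} → c₁ ≤ (o + C) * k + o → c₂ ≤ C → suc (c₁ + c₂) ≤ (o + C) * suc k + 1
slack-miss o C k c₁≤ c₂≤ = ≤-trans (s≤s (+-mono-≤ c₁≤ c₂≤)) (≤-reflexive (shuffle o C k))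
  where
  shuffle : ∀ o C k → suc ((o + C) * k + o + C) ≡ (o + C) * suc k + 1
  shuffle = solve-∀

-- The memoised fold over the dag of a normal value: every miss adds a memo entry, whose key is
-- a distinct constructor vertex of the budget, and costs a bounded amount besides the misses
-- below it; so cost and allocation are amortised against the number of memo entries.
module FoldBound {Γ} (ρ : Env Γ) (P : PF) (g : GTy) (e₀ : Term (Papp P (S g) ∷ Γ) (gr (S g)))
                 (body-sound : Sound e₀) {H₁ : Heap} {A₁ : List ℕ} {F : Region} {a : ℕ}
                 (wf₁ : WF H₁) (ρ-ok : EnvVal H₁ A₁ ⟪ F ⟫ Γ ρ) (a-ok : ValTy H₁ a (μ P))
                 (a∈A : AllCons H₁ a (_∈ A₁)) (a∈F : AllCons H₁ a ⟪ F ⟫)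
                 (F-fresh : ∀ b → length H₁ ≤ b → ⟪ F ⟫ b) where

  costPer allocPer : ℕ
  costPer  = overhead P + ⟦ cost (bound e₀) ⟧ (length A₁)
  allocPer = overhead P + ⟦ growth (bound e₀) ⟧ (length A₁)

  record MemoOk (Hc : Heap) (M : Memo) : Set where
    field
      extends : H₁ ⊑ Hc
      acyclic : WF Hc
      unique  : Unique (keys M)
      keys∈A  : keys M ⊆ᴸ A₁
      entries : ∀ k {r} → lookupM M k ≡ just r → Value Hc A₁ (S g) r × AllCons Hc r ⟪ F ⟫
  open MemoOk

  MemoOk-⊑ : ∀ {Hc Hc′ M} → MemoOk Hc M → Hc ⊑ Hc′ → WF Hc′ → MemoOk Hc′ M
  MemoOk-⊑ ok ext wf′ = record
    { extends = ⊑-trans (extends ok) ext ; acyclic = wf′ ; unique = unique ok ; keys∈A = keys∈A ok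
    ; entries = λ k eq → let (v , inF) = entries ok k eq in
        Value-⊑ (acyclic ok) ext (S g) v , AllCons-⊑ (acyclic ok) ext (Value⇒< (S g) v) inF }

  MemoOk-insert : ∀ {Hc M x r} → MemoOk Hc M → x ∉ keys M → x ∈ A₁ →
                  Value Hc A₁ (S g) r → AllCons Hc r ⟪ F ⟫ → MemoOk Hc ((x , r) ∷ M)
  MemoOk-insert {M = M} {x} {r} ok x∉ x∈A vr r∈F = record
    { extends = extends ok ; acyclic = acyclic ok
    ; unique  = All.tabulate (λ k∈ x≡k → x∉ (subst (_∈ _) (sym x≡k) k∈)) ∷ unique ok
    ; keys∈A  = λ { (here refl) → x∈A ; (there k∈) → keys∈A ok k∈ }
    ; entries = λ k eq → [ (λ { refl → vr , r∈F }) , entries ok k ]′ (lookupM-∷ M k x r eq) }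

  -- A run at x adds memo entries only for vertices reachable from x, so with keys ≤ x;
  -- this is what keeps the keys unique when x itself is added after the run below it.
  record Outcome (Hc : Heap) (M : Memo) (x s : ℕ) (ty : GTy) (Runs : Heap → Memo → ℕ → ℕ → Set) : Set where
    constructor outcome
    field
      heap′   : Heap
      memo′   : Memo
      result  : ℕ
      cost    : ℕ
      runs    : Runs heap′ memo′ result cost
      added   : Memo
      memo≡   : memo′ ≡ added ++ M
      added≤x : ∀ {k} → k ∈ keys added → k ≤ x
      memoOk  : MemoOk heap′ memo′
      cost≤   : cost ≤ costPer * length added + s
      Y       : Heap
      heap≡   : heap′ ≡ Hc ++ Y
      Y≤      : length Y ≤ allocPer * length added + s
      value   : Value heap′ A₁ ty result
      inF     : AllCons heap′ result ⟪ F ⟫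

  FoldOutcome : Heap → Memo → ℕ → Set
  FoldOutcome Hc M x = Outcome Hc M x 1 (S g) (FoldAt ρ P g e₀ Hc M x)

  MapOutcome : PF → Heap → Memo → ℕ → Set
  MapOutcome Q Hc M y = Outcome Hc M y (overhead Q) (Papp Q (S g)) (PMap ρ P g e₀ Q Hc M y)

  private
    child< : ∀ {y v d} → H₁ ! y ≡ just v → ChildOf v d → d < y
    child< {y} {v} {d} = wf₁ y v d

    F-new : ∀ {Hc} → H₁ ⊑ Hc → ∀ b → ⟪ F ∪≥ length Hc ⟫ b → ⟪ F ⟫ b
    F-new ext b (inj₁ p)    = p
    F-new ext b (inj₂ Hc≤b) = F-fresh b (≤-trans (⊑-length ext) Hc≤b)

  mutual
    fold-at : ∀ x → Acc _<_ x → Reach H₁ a x → ValTy H₁ x (μ P) → ∀ Hc M → MemoOk Hc M → FoldOutcome Hc M x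
    fold-at x _ _ _ Hc M ok with lookupM M x in hit
    ... | just r =
      let (v , inF) = entries ok x hit in
      outcome Hc M r 1 (f-hit hit) [] refl (λ ()) ok (m≤n+m 1 _) [] (sym (++-identityʳ Hc)) z≤n v inF
    fold-at x (acc below) a⇝x (tcon {b = b} x↦ vb) Hc M ok | nothing
      with fold-map P b (below (child< x↦ ccon)) (reach-trans a⇝x (rstep x↦ ccon rrefl)) vb Hc M ok
    ... | outcome _ _ b′ c₁ pm added₁ refl added₁≤b ok₁ c₁≤ Y₁ refl Y₁≤ vb′ b′∈F
      with body-sound (Hc ++ Y₁) (b′ ∷ ρ) A₁ F (acyclic ok₁)
             ((vb′ , b′∈F) , EnvVal-mono wf₁ (extends ok₁) ⊆-refl (λ _ p → p) Γ ρ ρ-ok)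
    ... | good _ (addr r) c₂ ev c₂≤ Y₂ refl Y₂≤ wf₂ (vr , r∈F) =
      outcome ((Hc ++ Y₁) ++ Y₂) ((x , r) ∷ (added₁ ++ M)) r (suc (c₁ + c₂))
        (f-miss hit (⊑-lookup (extends ok) x↦) pm ev) ((x , r) ∷ added₁) refl added≤x
        (MemoOk-insert (MemoOk-⊑ ok₁ (Y₂ , refl) wf₂) x∉ (a∈A x a⇝x (_ , b , x↦)) vr′ r∈F′)
        (slack-miss (overhead P) _ (length added₁) c₁≤ c₂≤)
        (Y₁ ++ Y₂) (++-assoc Hc Y₁ Y₂)
        (≤-trans (length-++-≤ Y₁ Y₂ Y₁≤ Y₂≤) (≤-trans (n≤1+n _) (slack-miss (overhead P) _ (length added₁) ≤-refl ≤-refl)))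
        vr′ r∈F′
      where
      b<x : b < x
      b<x = child< x↦ ccon
      vr′ : Value ((Hc ++ Y₁) ++ Y₂) A₁ (S g) r
      vr′ = Value-S-any g vr
      r∈F′ : AllCons ((Hc ++ Y₁) ++ Y₂) r ⟪ F ⟫
      r∈F′ = AllCons-mono (F-new (extends ok₁)) r∈F
      added≤x : ∀ {k} → k ∈ keys ((x , r) ∷ added₁) → k ≤ x
      added≤x (here refl) = ≤-refl
      added≤x (there k∈)  = ≤-trans (added₁≤b k∈) (<⇒≤ b<x)
      x∉ : x ∉ keys (added₁ ++ M)
      x∉ x∈ with keys-++⁻ added₁ M x∈
      ... | inj₁ x∈added = <⇒≱ b<x (added₁≤b x∈added)
      ... | inj₂ x∈M     = lookupM-nothing⇒∉ M x hit x∈M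

    fold-map : ∀ Q y → Acc _<_ y → Reach H₁ a y → ValTy H₁ y (PappTy Q (μ P)) → ∀ Hc M → MemoOk Hc M →
               MapOutcome Q Hc M y
    fold-map Id y ac a⇝y vy Hc M ok with fold-at y ac a⇝y vy Hc M ok
    ... | outcome H′ M′ r c fa added eq added≤ ok′ c≤ Y heq Y≤ v inF =
      outcome H′ M′ r (suc c) (p-id fa) added eq added≤ ok′ (slack-suc _ c≤ ≤-refl)
        Y heq (≤-trans Y≤ (+-monoʳ-≤ _ (n≤1+n 1))) v inF
    fold-map (K s) y ac a⇝y vy Hc M ok =
      outcome Hc M y 1 p-K [] refl (λ ()) ok (m≤n+m 1 _) [] (sym (++-identityʳ Hc)) z≤n
        (ValTy⇒Value ⌈ s ⌉ (subst (ValTy Hc y) (sym (erase-⌈⌉ s)) (ValTy-⊑ (extends ok) vy))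
          (AllCons-⊑ wf₁ (extends ok) (ValTy⇒< vy) (AllCons-reach a∈A a⇝y)))
        (AllCons-⊑ wf₁ (extends ok) (ValTy⇒< vy) (AllCons-reach a∈F a⇝y))
    fold-map (Q₁ ⊕ Q₂) y (acc below) a⇝y (tinl {b = d} y↦ vd) Hc M ok =
      fold-map-inj Q₁ Q₂ ι₁ y↦ d<y ok (fold-map Q₁ d (below d<y) (reach-trans a⇝y (rstep y↦ cinj rrefl)) vd Hc M ok)
        (m≤m+n _ _) λ y′↦ v → _ , inj₁ (y′↦ , v)
      where d<y = child< y↦ cinj
    fold-map (Q₁ ⊕ Q₂) y (acc below) a⇝y (tinr {b = d} y↦ vd) Hc M ok =
      fold-map-inj Q₁ Q₂ ι₂ y↦ d<y ok (fold-map Q₂ d (below d<y) (reach-trans a⇝y (rstep y↦ cinj rrefl)) vd Hc M ok)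
        (m≤n+m _ _) λ y′↦ v → _ , inj₂ (y′↦ , v)
      where d<y = child< y↦ cinj
    fold-map (Q₁ ⊗ Q₂) y (acc below) a⇝y (tpair {b = d₁} {c = d₂} y↦ v₁ v₂) Hc M ok
      with fold-map Q₁ d₁ (below (child< y↦ cpair₁)) (reach-trans a⇝y (rstep y↦ cpair₁ rrefl)) v₁ Hc M ok
    ... | outcome _ _ d₁′ c₁ pm₁ added₁ refl added₁≤ ok₁ c₁≤ Y₁ refl Y₁≤ vd₁ d₁∈F
      with fold-map Q₂ d₂ (below (child< y↦ cpair₂)) (reach-trans a⇝y (rstep y↦ cpair₂ rrefl)) v₂ (Hc ++ Y₁) (added₁ ++ M) ok₁
    ... | outcome _ _ d₂′ c₂ pm₂ added₂ refl added₂≤ ok₂ c₂≤ Y₂ refl Y₂≤ vd₂ d₂∈F =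
      outcome (H₂ ∷ʳ vpair d₁′ d₂′) (added₂ ++ (added₁ ++ M)) (length H₂) (suc (c₁ + c₂))
        (p-prod (⊑-lookup (extends ok) y↦) pm₁ pm₂) (added₂ ++ added₁) (sym (++-assoc added₂ added₁ M)) added≤y
        (MemoOk-⊑ ok₂ (⊑-∷ʳ _) wf′)
        (slack-prod costPer (length-++ added₂) c₁≤ c₂≤) ((Y₁ ++ Y₂) ∷ʳ vpair d₁′ d₂′) heap≡′
        (≤-trans (≤-reflexive |Y|) (slack-prod allocPer (length-++ added₂) Y₁≤ Y₂≤))
        (_ , _ , !-∷ʳ-length H₂ _ , Value-⊑ (acyclic ok₂) (⊑-∷ʳ _) _ vd₁″ , Value-⊑ (acyclic ok₂) (⊑-∷ʳ _) _ vd₂)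
        (AllCons-nonCon (!-∷ʳ-length H₂ _) (λ _ _ ())
          λ { _ cpair₁ → AllCons-⊑ (acyclic ok₂) (⊑-∷ʳ _) (Value⇒< _ vd₁″)
                           (AllCons-⊑ (acyclic ok₁) (Y₂ , refl) (Value⇒< _ vd₁) d₁∈F)
            ; _ cpair₂ → AllCons-⊑ (acyclic ok₂) (⊑-∷ʳ _) (Value⇒< _ vd₂) d₂∈F })
      where
      H₂ = (Hc ++ Y₁) ++ Y₂
      d₁<y = child< y↦ cpair₁
      d₂<y = child< y↦ cpair₂
      vd₁″ : Value H₂ A₁ (Papp Q₁ (S g)) d₁′
      vd₁″ = Value-⊑ (acyclic ok₁) (Y₂ , refl) _ vd₁
      wf′ : WF (H₂ ∷ʳ vpair d₁′ d₂′)
      wf′ = WF-∷ʳ {H₂} _ (acyclic ok₂) λ { _ cpair₁ → Value⇒< _ vd₁″ ; _ cpair₂ → Value⇒< _ vd₂ }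
      heap≡′ : H₂ ∷ʳ vpair d₁′ d₂′ ≡ Hc ++ ((Y₁ ++ Y₂) ∷ʳ vpair d₁′ d₂′)
      heap≡′ = trans (cong (_∷ʳ _) (++-assoc Hc Y₁ Y₂)) (++-assoc Hc (Y₁ ++ Y₂) _)
      |Y| : length ((Y₁ ++ Y₂) ∷ʳ vpair d₁′ d₂′) ≡ suc (length Y₁ + length Y₂)
      |Y| = trans (length-∷ʳ (Y₁ ++ Y₂) _) (cong suc (length-++ Y₁))
      added≤y : ∀ {k} → k ∈ keys (added₂ ++ added₁) → k ≤ y
      added≤y k∈ with keys-++⁻ added₂ added₁ k∈
      ... | inj₁ k∈₂ = ≤-trans (added₂≤ k∈₂) (<⇒≤ d₂<y)
      ... | inj₂ k∈₁ = ≤-trans (added₁≤ k∈₁) (<⇒≤ d₁<y)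

    fold-map-inj : ∀ Q₁ Q₂ s {y d Hc M} → H₁ ! y ≡ just (vinj s d) → d < y → MemoOk Hc M →
                   MapOutcome (select s Q₁ Q₂) Hc M d → overhead (select s Q₁ Q₂) ≤ overhead Q₁ + overhead Q₂ →
                   (∀ {H y′ d′} → H ! y′ ≡ just (vinj s d′) → Value H A₁ (Papp (select s Q₁ Q₂) (S g)) d′ →
                    Value H A₁ (Papp (Q₁ ⊕ Q₂) (S g)) y′) →
                   MapOutcome (Q₁ ⊕ Q₂) Hc M y
    fold-map-inj Q₁ Q₂ s {Hc = Hc} y↦ d<y ok (outcome _ M′ d′ c pm added memo≡ added≤ ok′ c≤ Y refl Y≤ vd d∈F) o≤ inject =
      outcome ((Hc ++ Y) ∷ʳ vinj s d′) M′ (length (Hc ++ Y)) (suc c) (p-sum (⊑-lookup (extends ok) y↦) pm)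
        added memo≡ (λ k∈ → ≤-trans (added≤ k∈) (<⇒≤ d<y)) (MemoOk-⊑ ok′ (⊑-∷ʳ _) wf′)
        (slack-suc _ c≤ o≤) (Y ∷ʳ vinj s d′) (++-assoc Hc Y _)
        (subst (_≤ _) (sym (length-∷ʳ Y _)) (slack-suc _ Y≤ o≤))
        (inject (!-∷ʳ-length (Hc ++ Y) _) (Value-⊑ (acyclic ok′) (⊑-∷ʳ _) _ vd))
        (AllCons-nonCon (!-∷ʳ-length (Hc ++ Y) _) (λ _ _ ())
          λ { _ cinj → AllCons-⊑ (acyclic ok′) (⊑-∷ʳ _) (Value⇒< _ vd) d∈F })
      where
      wf′ : WF ((Hc ++ Y) ∷ʳ vinj s d′)
      wf′ = WF-∷ʳ {Hc ++ Y} _ (acyclic ok′) λ { _ cinj → Value⇒< _ vd }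

  memo-size : ∀ {Hc x s ty Runs} (o : Outcome Hc [] x s ty Runs) → length (Outcome.added o) ≤ length A₁
  memo-size (outcome _ _ _ _ _ added refl _ ok _ _ _ _ _ _) =
    subst (_≤ length A₁) (trans (length-map proj₁ (added ++ [])) (cong length (++-identityʳ added)))
      (Unique-⊆⇒length-≤ (unique ok) (keys∈A ok))

  memo-empty : MemoOk H₁ []
  memo-empty = record { extends = ⊑-refl ; acyclic = wf₁ ; unique = [] ; keys∈A = λ () ; entries = λ _ () }

  fold-outcome : FoldOutcome H₁ [] a
  fold-outcome = fold-at a (<-wellFounded a) rrefl a-ok H₁ [] memo-empty

  fold-bounded : ∃ λ (o : FoldOutcome H₁ [] a) → length (Outcome.added o) ≤ length A₁
  fold-bounded = fold-outcome , memo-size fold-outcome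

-- The fundamental lemma

grow-⊑ : ∀ A H {X X′} → (H ++ X) ⊑ (H ++ X′) → grow A H X ⊆ᴸ grow A H X′
grow-⊑ A H {X} (Z , eq) rewrite ++-cancelˡ H _ _ (trans eq (++-assoc H X Z)) = grow-⊆ A H X Z

grow-≤ : ∀ A H X {p} → length X ≤ ⟦ p ⟧ (length A) → length (grow A H X) ≤ ⟦ after p ⟧ (length A)
grow-≤ A H X X≤ = ≤-trans (≤-reflexive (length-grow A H X)) (+-monoʳ-≤ (length A) X≤)

≤-after : ∀ p g₁ A H X {c} → length X ≤ ⟦ g₁ ⟧ (length A) → c ≤ ⟦ p ⟧ (length (grow A H X)) →
          c ≤ ⟦ p ∘ₚ after g₁ ⟧ (length A)
≤-after p g₁ A H X X≤ c≤ = ≤-trans c≤ (⟦⟧-mono-∘ₚ p (after g₁) (length A) (grow-≤ A H X {g₁} X≤))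

length-∷ʳ-≤ : ∀ (X : Heap) v {n} → length X ≤ n → length (X ∷ʳ v) ≤ n + 1
length-∷ʳ-≤ X v X≤ = ≤-trans (≤-reflexive (length-∷ʳ X v)) (≤-trans (s≤s X≤) (≤-reflexive (+-comm 1 _)))

EnvVal-grow : ∀ {H A F Γ} X {ρ : Env Γ} → WF H → EnvVal H A ⟪ F ⟫ Γ ρ →
              EnvVal (H ++ X) (grow A H X) ⟪ F ∪≥ length H ⟫ Γ ρ
EnvVal-grow {A = A} {F} {Γ} X {ρ} wf = EnvVal-mono wf (X , refl) (xs⊆xs++ys A _) (∪≥-⊆ F _) Γ ρ

Related-seq : ∀ t bd {A F} H X₁ X₂ {H′} v → WF H′ →
              Related t bd H′ (grow (grow A H X₁) (H ++ X₁) X₂) ((F ∪≥ length H) ∪≥ length (H ++ X₁)) v →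
              Related t bd H′ (grow A H (X₁ ++ X₂)) (F ∪≥ length H) v
Related-seq t bd {A} {F} H X₁ X₂ v wf =
  Related-mono t bd v wf ⊑-refl (⊆-reflexive (grow-++ A H X₁ X₂)) (∪≥-absorb F (⊑-length {xs = H} (X₁ , refl)))

Related-later : ∀ t bd {A F} H {X X′ H₁ H₂} v → WF H₁ → H₁ ≡ H ++ X → H₂ ≡ H ++ X′ → H₁ ⊑ H₂ →
                Related t bd H₁ (grow A H X) (F ∪≥ length H) v → Related t bd H₂ (grow A H X′) (F ∪≥ length H) v
Related-later t bd {A} H v wf refl refl ext = Related-mono t bd v wf ext (grow-⊑ A H ext) (λ _ p → p)

per-vertex-≤ : ∀ o p g₁ A H X {k c} → length X ≤ ⟦ g₁ ⟧ (length A) → k ≤ length (grow A H X) →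
               c ≤ (o + ⟦ p ⟧ (length (grow A H X))) * k + 1 →
               c ≤ ⟦ (⌜ o ⌝ ⊞ (p ∘ₚ after g₁)) ⊠ after g₁ ⊞ ⌜ 1 ⌝ ⟧ (length A)
per-vertex-≤ o p g₁ A H X X≤ k≤ c≤ =
  ≤-trans c≤ (+-monoˡ-≤ 1 (*-mono-≤ (+-monoʳ-≤ o (⟦⟧-mono-∘ₚ p (after g₁) (length A) budget≤)) (≤-trans k≤ budget≤)))
  where budget≤ = grow-≤ A H X {g₁} X≤

Value-alloc : ∀ {H A} X v g {b} → WF (H ++ X) → Value (H ++ X) (grow A H X) g b →
              Value ((H ++ X) ∷ʳ v) (grow A H (X ∷ʳ v)) g b
Value-alloc {H} {A} X v g wf val = Value-⊑ wf (⊑-∷ʳ v) g (Value-mono (grow-⊆ A H X [ v ]) g val)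

sound : ∀ {Γ t} (e : Term Γ t) → Sound e
sound (var {g} x) H ρ A F wf ρ-ok =
  let (v , cons) = EnvVal-lookup ρ ρ-ok x in
  good H _ 1 e-var ≤-refl [] (sym (++-identityʳ H)) z≤n wf
    (Value-mono (xs⊆xs++ys A _) g v , AllCons-mono (∪≥-⊆ F _) cons)
sound unit H ρ A F wf ρ-ok =
  good _ _ 1 e-unit ≤-refl [ vunit ] refl ≤-refl (WF-∷ʳ {H} vunit wf λ _ ())
    (!-∷ʳ-length H vunit , AllCons-nonCon (!-∷ʳ-length H vunit) (λ _ _ ()) λ _ ())
sound (lam e) H ρ A F wf ρ-ok =
  good H _ 1 e-lam ≤-refl [] (sym (++-identityʳ H)) z≤n wf
    λ H′ A′ F′ a ext A⊆ F⊆ wf′ v cons → sound e H′ (a ∷ ρ) A′ F′ wf′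
      ((v , cons) , EnvVal-mono wf ext (⊆-trans (xs⊆xs++ys A _) A⊆) (λ b p → F⊆ b (inj₁ p)) _ ρ ρ-ok)
sound (fst e) H ρ A F wf ρ-ok with sound e H ρ A F wf ρ-ok
... | good _ (addr a) c ev c≤ X refl X≤ wf₁ ((_ , _ , a↦ , v₁ , _) , cons) =
  good _ _ (suc c) (e-fst ev a↦) (s≤s c≤) X refl X≤ wf₁ (v₁ , AllCons-child a↦ cpair₁ cons)
sound (snd e) H ρ A F wf ρ-ok with sound e H ρ A F wf ρ-ok
... | good _ (addr a) c ev c≤ X refl X≤ wf₁ ((_ , _ , a↦ , _ , v₂) , cons) =
  good _ _ (suc c) (e-snd ev a↦) (s≤s c≤) X refl X≤ wf₁ (v₂ , AllCons-child a↦ cpair₂ cons)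
sound (des P e) H ρ A F wf ρ-ok with sound e H ρ A F wf ρ-ok
... | good _ (addr a) c ev c≤ X refl X≤ wf₁ ((tcon a↦ vb , a∈A) , cons) =
  good _ _ (suc c) (e-des ev a↦) (s≤s c≤) X refl X≤ wf₁
    (ValTy⇒Value (Papp P (μ nrm P)) (subst (ValTy _ _) (sym (erase-Papp P (μ nrm P))) vb) (AllCons-child a↦ ccon a∈A) ,
     AllCons-child a↦ ccon cons)
sound (sdes P e) H ρ A F wf ρ-ok with sound e H ρ A F wf ρ-ok
... | good _ (addr a) c ev c≤ X refl X≤ wf₁ (tcon a↦ vb , cons) =
  good _ _ (suc c) (e-sdes ev a↦) (s≤s c≤) X refl X≤ wf₁
    (ValTy⇒Value-S (Papp P (μ nrm P)) (subst (ValTy _ _) (sym (erase-Papp P (μ nrm P))) vb) , AllCons-child a↦ ccon cons)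
sound (inl {g} e) H ρ A F wf ρ-ok with sound e H ρ A F wf ρ-ok
... | good _ (addr a) c ev c≤ X refl X≤ wf₁ (v , cons) =
  good _ _ (suc c) (e-inl ev) (s≤s c≤) (X ∷ʳ u) (++-assoc H X [ u ]) (length-∷ʳ-≤ X u X≤)
    (WF-∷ʳ {H ++ X} u wf₁ λ { _ cinj → Value⇒< g v })
    ((a , inj₁ (!-∷ʳ-length (H ++ X) u , Value-alloc X u g wf₁ v)) ,
     AllCons-nonCon (!-∷ʳ-length (H ++ X) u) (λ _ _ ()) λ { _ cinj → AllCons-⊑ wf₁ (⊑-∷ʳ u) (Value⇒< g v) cons })
  where u = vinj ι₁ a
sound (inr {h = h} e) H ρ A F wf ρ-ok with sound e H ρ A F wf ρ-ok
... | good _ (addr a) c ev c≤ X refl X≤ wf₁ (v , cons) =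
  good _ _ (suc c) (e-inr ev) (s≤s c≤) (X ∷ʳ u) (++-assoc H X [ u ]) (length-∷ʳ-≤ X u X≤)
    (WF-∷ʳ {H ++ X} u wf₁ λ { _ cinj → Value⇒< h v })
    ((a , inj₂ (!-∷ʳ-length (H ++ X) u , Value-alloc X u h wf₁ v)) ,
     AllCons-nonCon (!-∷ʳ-length (H ++ X) u) (λ _ _ ()) λ { _ cinj → AllCons-⊑ wf₁ (⊑-∷ʳ u) (Value⇒< h v) cons })
  where u = vinj ι₂ a
sound (con P e) H ρ A F wf ρ-ok with sound e H ρ A F wf ρ-ok
... | good _ (addr a) c ev c≤ X refl X≤ wf₁ (v , cons) =
  good _ _ (suc c) (e-con ev) (s≤s c≤) (X ∷ʳ u) (++-assoc H X [ u ]) (length-∷ʳ-≤ X u X≤)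
    (WF-∷ʳ {H ++ X} u wf₁ λ { _ ccon → Value⇒< gP v })
    ((tcon u↦ (ValTy-⊑ (⊑-∷ʳ u) (subst (ValTy _ a) (erase-Papp P (μ nrm P)) (Value⇒ValTy gP v))) ,
      AllCons-node u↦ (λ _ _ _ → ∈-grow-∷ʳ A H X u)
        λ { _ ccon → AllCons-⊑ wf₁ (⊑-∷ʳ u) (Value⇒< gP v)
                       (AllCons-mono (λ _ → grow-⊆ A H X [ u ]) (Value-normal⇒AllCons gP (Normal-Papp P P) v)) }) ,
     AllCons-node u↦ (λ _ _ _ → inj₂ (⊑-length {xs = H} (X , refl)))
       λ { _ ccon → AllCons-⊑ wf₁ (⊑-∷ʳ u) (Value⇒< gP v) cons })
  where
  gP = Papp P (μ nrm P)
  u = vcon P a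
  u↦ = !-∷ʳ-length (H ++ X) u
sound (scon P e) H ρ A F wf ρ-ok with sound e H ρ A F wf ρ-ok
... | good _ (addr a) c ev c≤ X refl X≤ wf₁ (v , cons) =
  good _ _ (suc c) (e-scon ev) (s≤s c≤) (X ∷ʳ u) (++-assoc H X [ u ]) (length-∷ʳ-≤ X u X≤)
    (WF-∷ʳ {H ++ X} u wf₁ λ { _ ccon → Value⇒< (S gP) v })
    (tcon u↦ (ValTy-⊑ (⊑-∷ʳ u) (subst (ValTy _ a) (trans (erase-S gP) (erase-Papp P (μ nrm P))) (Value⇒ValTy (S gP) v))) ,
     AllCons-node u↦ (λ _ _ _ → inj₂ (⊑-length {xs = H} (X , refl)))
       λ { _ ccon → AllCons-⊑ wf₁ (⊑-∷ʳ u) (Value⇒< (S gP) v) cons })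
  where
  gP = Papp P (μ nrm P)
  u = vcon P a
  u↦ = !-∷ʳ-length (H ++ X) u
sound (toSafe {g} e) H ρ A F wf ρ-ok with sound e H ρ A F wf ρ-ok
... | good _ (addr a) c ev c≤ X refl X≤ wf₁ (v , cons) =
  good _ _ (suc c) (e-toSafe ev) (s≤s c≤) X refl X≤ wf₁ (Value-S g v , cons)
-- The argument of toNorm sees only normal variables, whose constructor vertices lie in the
-- budget, so every constructor vertex of its result is in the budget or fresh.
sound (toNorm {Δ} {g} s nΔ e) H ρ A F wf ρ-ok
  with sound e H (restrict s ρ) A (A ∩ F) wf (EnvVal-normal Δ (restrict s ρ) nΔ (EnvVal-restrict s ρ ρ-ok))
... | good _ (addr a) c ev c≤ X refl X≤ wf₁ (v , cons) =
  good _ _ (suc c) (e-toNorm ev) (s≤s c≤) X refl X≤ wf₁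
    (ValTy⇒Value (N g) (subst (ValTy _ a) (sym (erase-N g)) (Value⇒ValTy g v))
       (λ b r isCon → in-budget (cons b r isCon) (IsCon⇒< (H ++ X) isCon)) ,
     AllCons-mono forget cons)
  where
  in-budget : ∀ {b} → ⟪ (A ∩ F) ∪≥ length H ⟫ b → b < length (H ++ X) → b ∈ grow A H X
  in-budget (inj₁ (b∈A , _)) _  = ∈-++⁺ˡ b∈A
  in-budget (inj₂ H≤b)       b< = ∈-grow A H X H≤b b<
  forget : ∀ b → ⟪ (A ∩ F) ∪≥ length H ⟫ b → ⟪ F ∪≥ length H ⟫ b
  forget b (inj₁ (_ , p)) = inj₁ p
  forget b (inj₂ H≤b)     = inj₂ H≤b
-- The numeral n takes 3 (n + 1) vertices, and n ≤ length of the budget by minimality.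
sound (cs P e) H ρ A F wf ρ-ok with sound e H ρ A F wf ρ-ok
... | good _ (addr a) c ev c≤ X refl X≤ wf₁ ((va , a∈A) , _) with minSize (H ++ X) a wf₁ (ValTy⇒< va)
... | n , min , n≤ =
  good _ _ (suc c) (e-cs ev min) (s≤s c≤) (X ++ added) heap≡′
    (length-++-≤ X added X≤ (≤-trans added≤ (*-monoʳ-≤ 3 (≤-trans (≤-reflexive (+-comm 1 n)) (+-monoˡ-≤ 1 n≤A)))))
    acyclic
    ((typed , λ b r isCon → ∈-grow A H (X ++ added) (H≤ b r)
                              (subst (b <_) (cong length heap≡′) (IsCon⇒< (proj₁ (numeral (H ++ X) n)) isCon))) ,
     λ b r _ → inj₂ (H≤ b r))
  where
  open NumeralIn (numeral-spec (H ++ X) n wf₁)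
  heap≡′ : proj₁ (numeral (H ++ X) n) ≡ H ++ (X ++ added)
  heap≡′ = trans heap≡ (++-assoc H X added)
  n≤A : n ≤ ⟦ after (growth (bound e)) ⟧ (length A)
  n≤A = ≤-trans (n≤ _ a∈A) (grow-≤ A H X {growth (bound e)} X≤)
  H≤ : ∀ b → Reach (proj₁ (numeral (H ++ X) n)) (proj₂ (numeral (H ++ X) n)) b → length H ≤ b
  H≤ b r = ≤-trans (⊑-length {xs = H} (X , refl)) (reach-fresh b r)
sound (pair {g} {h} e₁ e₂) H ρ A F wf ρ-ok with sound e₁ H ρ A F wf ρ-ok
... | good _ (addr a) c₁ ev₁ c₁≤ X₁ refl X₁≤ wf₁ ra
  with sound e₂ (H ++ X₁) ρ (grow A H X₁) (F ∪≥ length H) wf₁ (EnvVal-grow X₁ wf ρ-ok)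
... | good _ (addr b) c₂ ev₂ c₂≤ X₂ refl X₂≤ wf₂ rb =
  good _ _ (suc (c₁ + c₂)) (e-pair ev₁ ev₂) (s≤s (+-mono-≤ c₁≤ (≤-after (cost (bound e₂)) g₁ A H X₁ X₁≤ c₂≤)))
    ((X₁ ++ X₂) ∷ʳ u) heap≡
    (length-∷ʳ-≤ (X₁ ++ X₂) u (length-++-≤ X₁ X₂ X₁≤ (≤-after (growth (bound e₂)) g₁ A H X₁ X₁≤ X₂≤)))
    (WF-∷ʳ {H₂} u wf₂ λ { _ cpair₁ → Value⇒< g (proj₁ ra′) ; _ cpair₂ → Value⇒< h (proj₁ rb′) })
    ((a , b , !-∷ʳ-length H₂ u , proj₁ ra″ , proj₁ rb″) ,
     AllCons-nonCon (!-∷ʳ-length H₂ u) (λ _ _ ()) λ { _ cpair₁ → proj₂ ra″ ; _ cpair₂ → proj₂ rb″ })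
  where
  g₁ = growth (bound e₁)
  u = vpair a b
  H₂ = (H ++ X₁) ++ X₂
  heap≡ : H₂ ∷ʳ u ≡ H ++ ((X₁ ++ X₂) ∷ʳ u)
  heap≡ = trans (cong (_∷ʳ u) (++-assoc H X₁ X₂)) (++-assoc H (X₁ ++ X₂) [ u ])
  ra′ = Related-later (gr g) tt H (addr a) wf₁ refl (++-assoc H X₁ X₂) (X₂ , refl) ra
  rb′ = Related-seq (gr h) tt H X₁ X₂ (addr b) wf₂ rb
  ra″ = Related-later (gr g) tt H (addr a) wf₂ (++-assoc H X₁ X₂) heap≡ (⊑-∷ʳ u) ra′
  rb″ = Related-later (gr h) tt H (addr b) wf₂ (++-assoc H X₁ X₂) heap≡ (⊑-∷ʳ u) rb′
sound (app {g} {t} e₁ e₂) H ρ A F wf ρ-ok with sound e₁ H ρ A F wf ρ-ok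
... | good _ (clo ρ′ b) c₁ ev₁ c₁≤ X₁ refl X₁≤ wf₁ f
  with sound e₂ (H ++ X₁) ρ (grow A H X₁) (F ∪≥ length H) wf₁ (EnvVal-grow X₁ wf ρ-ok)
... | good _ (addr a) c₂ ev₂ c₂≤ X₂ refl X₂≤ wf₂ (va , a∈F)
  with f ((H ++ X₁) ++ X₂) _ _ a (X₂ , refl) (xs⊆xs++ys _ _) (∪≥-⊆ _ _) wf₂ va a∈F
... | good _ r c₃ ev₃ c₃≤ X₃ refl X₃≤ wf₃ rr =
  good _ r (suc (c₁ + c₂ + c₃)) (e-app ev₁ ev₂ ev₃)
    (s≤s (+-mono-≤ (+-mono-≤ c₁≤ (≤-after (cost (bound e₂)) g₁ A H X₁ X₁≤ c₂≤))
                   (≤-after cb g₁₂ A H (X₁ ++ X₂) X₁₂≤ (in-grow cb c₃≤))))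
    (X₁ ++ (X₂ ++ X₃)) (trans (++-assoc (H ++ X₁) X₂ X₃) (++-assoc H X₁ (X₂ ++ X₃)))
    (length-++-≤ X₁ (X₂ ++ X₃) X₁≤
      (length-++-≤ X₂ X₃ (≤-after g₂ g₁ A H X₁ X₁≤ X₂≤) (≤-after gb g₁₂ A H (X₁ ++ X₂) X₁₂≤ (in-grow gb X₃≤))))
    wf₃
    (Related-seq t _ H X₁ (X₂ ++ X₃) r wf₃ (Related-seq t _ (H ++ X₁) X₂ X₃ r wf₃ rr))
  where
  g₁ = growth (bound e₁)
  g₂ = growth (bound e₂)
  g₁₂ = g₁ ⊞ (g₂ ∘ₚ after g₁)
  cb = proj₁ (val (bound e₁))
  gb = proj₁ (proj₂ (val (bound e₁)))
  X₁₂≤ : length (X₁ ++ X₂) ≤ ⟦ g₁₂ ⟧ (length A)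
  X₁₂≤ = length-++-≤ X₁ X₂ X₁≤ (≤-after g₂ g₁ A H X₁ X₁≤ X₂≤)
  in-grow : ∀ {n} p → n ≤ ⟦ p ⟧ (length (grow (grow A H X₁) (H ++ X₁) X₂)) → n ≤ ⟦ p ⟧ (length (grow A H (X₁ ++ X₂)))
  in-grow p = subst (λ B → _ ≤ ⟦ p ⟧ (length B)) (grow-++ A H X₁ X₂)
sound (case {t = t} e _ e₁ e₂) H ρ A F wf ρ-ok with sound e H ρ A F wf ρ-ok
... | good _ (addr a) c ev c≤ X refl X≤ wf₁ ((b , inj₁ (a↦ , vb)) , cons)
  with sound e₁ (H ++ X) (b ∷ ρ) (grow A H X) (F ∪≥ length H) wf₁
         ((vb , AllCons-child a↦ cinj cons) , EnvVal-grow X wf ρ-ok)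
... | good _ r c₁ ev₁ c₁≤ X₁ refl X₁≤ wf₂ rr =
  good _ r (suc (c + c₁)) (e-case₁ ev a↦ ev₁) (s≤s (+-mono-≤ c≤ (≤-after cᵇ gᵉ A H X X≤ (≤-trans c₁≤ (m≤m+n _ _)))))
    (X ++ X₁) (++-assoc H X X₁) (length-++-≤ X X₁ X≤ (≤-after gᵇ gᵉ A H X X≤ (≤-trans X₁≤ (m≤m+n _ _)))) wf₂
    (Related-≤ᴮ t r (≤ᴮ-⊔ᴮˡ _ _) (Related-seq t _ H X X₁ r wf₂ rr))
  where
  gᵉ = growth (bound e)
  cᵇ = cost (bound e₁) ⊞ cost (bound e₂)
  gᵇ = growth (bound e₁) ⊞ growth (bound e₂)
sound (case {t = t} e _ e₁ e₂) H ρ A F wf ρ-ok | good _ (addr a) c ev c≤ X refl X≤ wf₁ ((b , inj₂ (a↦ , vb)) , cons)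
  with sound e₂ (H ++ X) (b ∷ ρ) (grow A H X) (F ∪≥ length H) wf₁
         ((vb , AllCons-child a↦ cinj cons) , EnvVal-grow X wf ρ-ok)
... | good _ r c₂ ev₂ c₂≤ X₂ refl X₂≤ wf₂ rr =
  good _ r (suc (c + c₂)) (e-case₂ ev a↦ ev₂) (s≤s (+-mono-≤ c≤ (≤-after cᵇ gᵉ A H X X≤ (≤-trans c₂≤ (m≤n+m _ _)))))
    (X ++ X₂) (++-assoc H X X₂) (length-++-≤ X X₂ X≤ (≤-after gᵇ gᵉ A H X X≤ (≤-trans X₂≤ (m≤n+m _ _)))) wf₂
    (Related-≤ᴮ t r (≤ᴮ-⊔ᴮʳ _ _) (Related-seq t _ H X X₂ r wf₂ rr))
  where
  gᵉ = growth (bound e)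
  cᵇ = cost (bound e₁) ⊞ cost (bound e₂)
  gᵇ = growth (bound e₁) ⊞ growth (bound e₂)
sound (fold P g e₀ e₁) H ρ A F wf ρ-ok with sound e₁ H ρ A F wf ρ-ok
... | good _ (addr a) c₁ ev₁ c₁≤ X₁ refl X₁≤ wf₁ ((va , a∈A) , a∈F)
  with FoldBound.fold-bounded ρ P g e₀ (sound e₀) wf₁ (EnvVal-grow X₁ wf ρ-ok) va a∈A a∈F
         (λ b H≤b → inj₂ (≤-trans (⊑-length {xs = H} (X₁ , refl)) H≤b))
... | FoldBound.outcome _ _ r c₂ fa added refl _ ok c₂≤ Y refl Y≤ v r∈F , added≤ =
  good _ _ (suc (c₁ + c₂)) (e-fold ev₁ fa)
    (s≤s (+-mono-≤ c₁≤ (per-vertex-≤ (overhead P) (cost (bound e₀)) g₁ A H X₁ X₁≤ added≤ c₂≤)))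
    (X₁ ++ Y) (++-assoc H X₁ Y)
    (length-++-≤ X₁ Y X₁≤ (per-vertex-≤ (overhead P) (growth (bound e₀)) g₁ A H X₁ X₁≤ added≤ Y≤))
    (FoldBound.MemoOk.acyclic ok) (Value-S-any g v , r∈F)
  where g₁ = growth (bound e₁)

runBound : ∀ {g₁ g₀} → Term [] (g₁ ⇒ gr g₀) → PolyExpr
runBound f = ⌜ 1 ⌝ ⊞ cost (bound f) ⊞ (proj₁ (val (bound f)) ∘ₚ after (growth (bound f)))

run-bounded : ∀ {g₁ g₀} (f : Term [] (g₁ ⇒ gr g₀)) (v : Dag) A → ValTy (heap v) (root v) (erase g₁) →
              AllCons (heap v) (root v) (_∈ A) → ∃ λ H′ → ∃ λ r → ∃ λ c → Run f v H′ r c × c ≤ ⟦ runBound f ⟧ (length A)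
run-bounded {g₁} f v A v-ok v∈A with sound f (heap v) [] A everywhere (wf v) tt
... | good _ (clo ρ′ b) c₁ ev₁ c₁≤ X refl X≤ wf₁ f-ok
  with f-ok (heap v ++ X) _ _ (root v) ⊑-refl ⊆-refl (λ _ p → p) wf₁
         (Value-⊑ (wf v) (X , refl) g₁ (Value-mono (xs⊆xs++ys A _) g₁ (ValTy⇒Value g₁ v-ok v∈A))) (λ _ _ _ → inj₁ tt)
... | good _ r c₂ ev₂ c₂≤ _ _ _ _ _ =
  _ , r , suc (c₁ + c₂) , run ev₁ ev₂ ,
  s≤s (+-mono-≤ c₁≤ (≤-after (proj₁ (val (bound f))) (growth (bound f)) A (heap v) X X≤ c₂≤))

run-deterministic : ∀ {g₁ t} {f : Term [] (g₁ ⇒ t)} {v H H′ r r′ c c′} → Run f v H r c → Run f v H′ r′ c′ → c ≡ c′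
run-deterministic (run d₁ d₂) (run d₁′ d₂′) with eval-deterministic d₁ d₁′
... | refl , refl , refl with eval-deterministic d₂ d₂′
... | refl , refl , refl = refl

theorem22 : ∀ {g₁ g₀ : GTy} (f : Term [] (g₁ ⇒ gr g₀)) → NormalG g₁ → DPPolyCost f
theorem22 f _ = toPolynomial (runBound f) , λ v v-ok →
  let A = conAddrs (heap v)
      (H′ , r , c , runs , c≤) = run-bounded f v A v-ok (λ b _ isCon → IsCon⇒∈conAddrs (heap v) b isCon)
      bound≡ : ⟦ runBound f ⟧ (length A) ≡ evalPoly (toPolynomial (runBound f)) (size v)
      bound≡ = trans (cong ⟦ runBound f ⟧ (length-conAddrs (heap v))) (sym (evalPoly-toPolynomial (runBound f) (size v)))
  in (H′ , r , c , runs) ,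
     λ H″ r′ c′ runs′ → subst (_≤ _) (run-deterministic runs runs′) (subst (c ≤_) bound≡ c≤)
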